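{- Let $H_1$ and $H_2$ be connected graphs with vertex-disjoint vertex sets, let $v_1\in V(H_1)$ and $v_2\in V(H_2)$, and let $G$ be the graph obtained from $H_1$ and $H_2$ by identifying $v_1$ and $v_2$ into a single vertex $v$. Put $\widetilde H_1=H_1-v_1$ and $\widetilde H_2=H_2-v_2$. Label the vertices of $G$ in the order $V(\widetilde H_1)$, $v$, $V(\widetilde H_2)$; label $H_1$ in the order $V(\widetilde H_1)$, $v_1$ and $H_2$ in the order $v_2$, $V(\widetilde H_2)$ (both $v_1$ and $v_2$ being identified with $v$). Let $\mathbf f_1$ (resp. $\mathbf f_2$) be the column vector obtained from $\mathbf f^{v}_{H_1}$ (resp. $\mathbf f^{v}_{H_2}$) by deleting its component indexed by $v$ (which is $0$), and let $F^{(1)}$ (resp. $F^{(2)}$) denote the principal submatrix of $F_{H_1}$ (resp. $F_{H_2}$) with rows and columns indexed by $V(\widetilde H_1)$ (resp. $V(\widetilde H_2)$). Then \[ \mathbf d_G^T=[\mathbf d_{H_1}^T\;\mathbf 0^T_{|V(\widetilde H_2)|}]+[\mathbf 0^T_{|V(\widetilde H_1)|}\;\mathbf d_{H_2}^T],\qquad m_G=m_{H_1}+m_{H_2},\qquad \tau_G=\tau_{H_1}\tau_{H_2}, \] \[ F_G=\left[\begin{array}{c|c|c} \tau_{H_2}F^{(1)} & \tau_{H_2}\mathbf f_1 & \tau_{H_2}\mathbf f_1\mathbf 1^T+\tau_{H_1}\mathbf 1\mathbf f_2^T\\\hline \tau_{H_2}\mathbf f_1^T & 0 & \tau_{H_1}\mathbf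 f_2^T\\\hline \tau_{H_1}\mathbf f_2\mathbf 1^T+\tau_{H_2}\mathbf 1\mathbf f_1^T & \tau_{H_1}\mathbf f_2 & \tau_{H_1}F^{(2)} \end{array}\right], \] where the all-ones vectors $\mathbf 1$ have the appropriate sizes. Furthermore, \[ \mathbf d_G^TF_G\mathbf d_G=\tau_{H_2}\mathbf d_{H_1}^TF_{H_1}\mathbf d_{H_1}+\tau_{H_1}\mathbf d_{H_2}^TF_{H_2}\mathbf d_{H_2}+4\tau_{H_2}m_{H_2}\mathbf d_{H_1}^T\mathbf f^{v}_{H_1}+4\tau_{H_1}m_{H_1}\mathbf d_{H_2}^T\mathbf f^{v}_{H_2}. \]
   Context: All graphs are finite, simple and undirected. For a graph $G$ with labelled vertices: $\mathbf d_G$ is the column vector of vertex degrees; $m_G=|E(G)|$; $\tau_G$ is the number of spanning trees of $G$; $F_G=[f^G_{i,j}]$ is the matrix whose $(i,j)$ entry $f^G_{i,j}$ is the number of spanning forests of $G$ consisting of exactly two trees, one containing $i$ and the other containing $j$ (so $f^G_{i,i}=0$); $\mathbf f^v_G$ denotes the column of $F_G$ indexed by the vertex $v$. -}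

module Defs where

open import Data.Nat using (ℕ; zero; suc; _+_; _*_; _≤_; _<ᵇ_)
open import Data.Bool using (Bool; true; false; _∧_; _∨_; if_then_else_)
open import Data.Fin using (Fin; zero; suc; toℕ; _↑ˡ_; _↑ʳ_; splitAt)
open import Data.Vec using (Vec; []; _∷_; lookup)
open import Data.List using (List; []; _∷_; map; concatMap; length; _∷ʳ_)
open import Data.List.Relation.Unary.Unique.Propositional using (Unique)
open import Data.List.Relation.Unary.Linked using (Linked)
open import Data.Maybe using (Maybe; just; nothing; maybe)
open import Data.Sum using (_⊎_; inj₁; inj₂)
open import Data.Product using (Σ; _×_; _,_)
open import Relation.Binary.PropositionalEquality using (_≡_)
open import Relation.Nullary using (¬_)

record Graph (n : ℕ) : Set where
  field
    adj   : Fin n → Fin n → Bool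
    sym   : ∀ i j → adj i j ≡ adj j i
    irr   : ∀ i → adj i i ≡ false
open Graph public

∑ : ∀ {n} → (Fin n → ℕ) → ℕ
∑ {zero}  f = 0
∑ {suc n} f = f zero + ∑ (λ i → f (suc i))

ind : Bool → ℕ
ind true  = 1
ind false = 0

deg : ∀ {n} → Graph n → Fin n → ℕ
deg G i = ∑ (λ j → ind (adj G i j))

numEdges : ∀ {n} → Graph n → ℕ
numEdges G = ∑ (λ i → ∑ (λ j → ind (adj G i j ∧ (toℕ i <ᵇ toℕ j))))

data Reach {n} (E : Fin n → Fin n → Bool) : Fin n → Fin n → Set where
  here : ∀ {u} → Reach E u u
  step : ∀ {u v w} → E u v ≡ true → Reach E v w → Reach E u w

Connected : ∀ {n} → Graph n → Set
Connected G = ∀ u w → Reach (adj G) u w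

Cycle : ∀ {n} → (Fin n → Fin n → Bool) → Set
Cycle {n} E = Σ (Fin n) λ x → Σ (List (Fin n)) λ ys →
  (2 ≤ length ys) × Unique (x ∷ ys) × Linked (λ u v → E u v ≡ true) ((x ∷ ys) ∷ʳ x)

Acyclic : ∀ {n} → (Fin n → Fin n → Bool) → Set
Acyclic E = ¬ Cycle E

Mat : ℕ → Set
Mat n = Vec (Vec Bool n) n

madj : ∀ {n} → Mat n → Fin n → Fin n → Bool
madj S i j = lookup (lookup S i) j

SpanSub : ∀ {n} → Graph n → Mat n → Set
SpanSub G S = (∀ i j → madj S i j ≡ madj S j i)
            × (∀ i j → madj S i j ≡ true → adj G i j ≡ true)

SpanningTree : ∀ {n} → Graph n → Mat n → Set
SpanningTree G S = SpanSub G S × Acyclic (madj S) × (∀ u w → Reach (madj S) u w)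

-- spanning forest with exactly two trees, one containing i, the other j
TwoForest : ∀ {n} → Graph n → Fin n → Fin n → Mat n → Set
TwoForest G i j S = SpanSub G S × Acyclic (madj S)
                  × ¬ Reach (madj S) i j
                  × (∀ u → Reach (madj S) i u ⊎ Reach (madj S) j u)

-- enumeration of all vectors / all n×n Boolean matrices (no duplicates)
allVecs : ∀ {A : Set} (k : ℕ) → List A → List (Vec A k)
allVecs zero    xs = [] ∷ []
allVecs (suc k) xs = concatMap (λ x → map (x ∷_) (allVecs k xs)) xs

allMats : (n : ℕ) → List (Mat n)
allMats n = allVecs n (allVecs n (true ∷ false ∷ []))

data Count {A : Set} (P : A → Set) : List A → ℕ → Set where
  nil  : Count P [] 0
  yes  : ∀ {x xs k} → P x → Count P xs k → Count P (x ∷ xs) (suc k)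
  no   : ∀ {x xs k} → ¬ P x → Count P xs k → Count P (x ∷ xs) k

IsNumSpanningTrees : ∀ {n} → Graph n → ℕ → Set
IsNumSpanningTrees {n} G t = Count (SpanningTree G) (allMats n) t

IsNumTwoForests : ∀ {n} → Graph n → Fin n → Fin n → ℕ → Set
IsNumTwoForests {n} G i j f = Count (TwoForest G i j) (allMats n) f

-- H₁ on Fin (a + 1): vertices of H̃₁ are i ↑ˡ 1 (i : Fin a),
-- v₁ = a ↑ʳ zero.  H₂ on Fin (suc b): v₂ = zero, vertices of H̃₂ are suc k.
-- G on Fin (a + suc b): H̃₁ first (i ↑ˡ suc b), v = a ↑ʳ zero,
-- then H̃₂ (a ↑ʳ suc k).

data Part (a b : ℕ) : Set where
  left  : Fin a → Part a b
  mid   : Part a b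
  right : Fin b → Part a b

classify : ∀ {a b} → Fin (a + suc b) → Part a b
classify {a} u with splitAt a u
... | inj₁ i       = left i
... | inj₂ zero    = mid
... | inj₂ (suc k) = right k

v₁ : ∀ {a} → Fin (a + 1)
v₁ {a} = a ↑ʳ zero

vG : ∀ {a b} → Fin (a + suc b)
vG {a} = a ↑ʳ zero

pre₁ : ∀ {a b} → Fin (a + suc b) → Maybe (Fin (a + 1))
pre₁ u with classify u
... | left i  = just (i ↑ˡ 1)
... | mid     = just v₁
... | right k = nothing

pre₂ : ∀ {a b} → Fin (a + suc b) → Maybe (Fin (suc b))
pre₂ u with classify u
... | left i  = nothing
... | mid     = just zero
... | right k = just (suc k)

liftAdj : ∀ {m} → (Fin m → Fin m → Bool) → Maybe (Fin m) → Maybe (Fin m) → Bool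
liftAdj E (just x) (just y) = E x y
liftAdj E _        _        = false

glueAdj : ∀ {a b} → Graph (a + 1) → Graph (suc b) → Fin (a + suc b) → Fin (a + suc b) → Bool
glueAdj H₁ H₂ u w = liftAdj (adj H₁) (pre₁ u) (pre₁ w) ∨ liftAdj (adj H₂) (pre₂ u) (pre₂ w)

-- the symmetry / irreflexivity proofs of G are left as fields to be supplied;
-- the statement quantifies over any Graph whose adjacency is glueAdj
IsGlue : ∀ {a b} → Graph (a + 1) → Graph (suc b) → Graph (a + suc b) → Set
IsGlue H₁ H₂ G = ∀ u w → adj G u w ≡ glueAdj H₁ H₂ u w

padL : ∀ {a b} → Graph (a + 1) → Fin (a + suc b) → ℕ
padL {b = b} H₁ u = maybe (deg H₁) 0 (pre₁ {b = b} u)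

padR : ∀ {a b} → Graph (suc b) → Fin (a + suc b) → ℕ
padR {a = a} H₂ u = maybe (deg H₂) 0 (pre₂ {a = a} u)

blockF : ∀ {a b} (t₁ t₂ : ℕ) → (Fin (a + 1) → Fin (a + 1) → ℕ) → (Fin (suc b) → Fin (suc b) → ℕ)
       → Fin (a + suc b) → Fin (a + suc b) → ℕ
blockF {a} {b} t₁ t₂ F₁ F₂ u w = go (classify u) (classify w)
  where
  f₁ : Fin a → ℕ
  f₁ i = F₁ (i ↑ˡ 1) v₁
  f₂ : Fin b → ℕ
  f₂ k = F₂ (suc k) zero
  go : Part a b → Part a b → ℕ
  go (left i)  (left i')  = t₂ * F₁ (i ↑ˡ 1) (i' ↑ˡ 1)
  go (left i)  mid        = t₂ * f₁ i
  go (left i)  (right k)  = t₂ * f₁ i + t₁ * f₂ k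
  go mid       (left i)   = t₂ * f₁ i
  go mid       mid        = 0
  go mid       (right k)  = t₁ * f₂ k
  go (right k) (left i)   = t₁ * f₂ k + t₂ * f₁ i
  go (right k) mid        = t₁ * f₂ k
  go (right k) (right k') = t₁ * F₂ (suc k) (suc k')

quad : ∀ {n} → (Fin n → ℕ) → (Fin n → Fin n → ℕ) → ℕ
quad d F = ∑ (λ i → ∑ (λ j → d i * F i j * d j))

dot : ∀ {n} → (Fin n → ℕ) → (Fin n → ℕ) → ℕ
dot d f = ∑ (λ i → d i * f i)

module Submission where

-- A spanning subgraph S of G is the union of its restrictions S₁ ⊆ H₁ and S₂ ⊆ H₂, and since
-- H₁ and H₂ share only the cut vertex v, cycles and walks of S split at v into cycles and walks
-- of S₁ and S₂. Hence S is a spanning tree iff S₁ and S₂ are; S is a two-tree forest separating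
-- two vertices of the same side iff it separates them on that side and is a tree on the other;
-- and S separates i ∈ H̃₁ from j ∈ H̃₂ iff either S₁ separates i from v and S₂ is a tree, or
-- S₁ is a tree and S₂ separates v from j. Counting pairs (S₁, S₂) gives τ_G = τ₁τ₂ and the
-- block form of F_G; degrees and edges add up blockwise, and the quadratic form follows by
-- summing the nine blocks and using 2m = Σ d (handshake).

open import Defs renaming (yes to counted; no to skipped)
open import Algebra.Properties.CommutativeSemigroup using (interchange)
open import Data.Bool using (Bool; true; false; _∧_; _∨_)
open import Data.Bool.Properties using (∨-comm; ∨-identityʳ; ∨-zeroʳ; ∨-idem; ∧-identityʳ)
  renaming (_≟_ to _≟ᴮ_)
open import Data.Empty using (⊥; ⊥-elim)
open import Data.Fin using (Fin; zero; suc; toℕ; _↑ˡ_; _↑ʳ_; splitAt; _≟_)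
open import Data.Fin.Properties
  using (splitAt-↑ˡ; splitAt-↑ʳ; splitAt⁻¹-↑ˡ; splitAt⁻¹-↑ʳ; toℕ-↑ˡ; toℕ-↑ʳ; toℕ-injective)
open import Data.List using (List; []; _∷_; map; length; concatMap; _++_; _∷ʳ_)
open import Data.List.Membership.Propositional using (_∈_)
open import Data.List.Properties using (length-map; map-++)
open import Data.List.Relation.Unary.All using (All; []; _∷_)
open import Data.List.Relation.Unary.AllPairs using (AllPairs; []; _∷_)
open import Data.List.Relation.Unary.Any using (here; there)
open import Data.List.Relation.Unary.Linked using (Linked; []; [-]; _∷_)
open import Data.Maybe using (Maybe; just; nothing; maybe; fromMaybe)
open import Data.Maybe.Properties using (just-injective)
open import Data.Nat using (ℕ; zero; suc; _+_; _*_; _≤_; _<ᵇ_)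
open import Data.Nat.Properties
  using (0≢1+n; +-assoc; +-comm; *-comm; *-zeroʳ; *-identityʳ; +-identityʳ; *-distribˡ-+; +-commutativeSemigroup)
open import Data.Nat.Tactic.RingSolver using (solve-∀)
open import Data.Product using (Σ; _×_; _,_; proj₁; proj₂)
open import Data.Sum using (_⊎_; inj₁; inj₂) renaming (swap to ⊎-swap)
open import Data.Unit using (⊤; tt)
open import Data.Vec using ([]; _∷_; lookup; tabulate)
open import Data.Vec.Properties using (≡-dec; lookup∘tabulate; tabulate∘lookup; tabulate-cong)
open import Relation.Binary.Definitions using (DecidableEquality)
open import Relation.Binary.PropositionalEquality
  using (_≡_; refl; trans; cong; cong₂; subst; subst₂; module ≡-Reasoning)
  renaming (sym to ≡-sym)
open import Relation.Nullary using (¬_; Dec; yes; no)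
open import Relation.Nullary.Decidable using (_×-dec_; _⊎-dec_)

∨-true : ∀ {x y} → x ∨ y ≡ true → x ≡ true ⊎ y ≡ true
∨-true {true}  _ = inj₁ refl
∨-true {false} e = inj₂ e

liftAdj-true : ∀ {m} (E : Fin m → Fin m → Bool) x y → liftAdj E x y ≡ true
  → Σ (Fin m) λ p → Σ (Fin m) λ q → x ≡ just p × y ≡ just q × E p q ≡ true
liftAdj-true E (just p) (just q) e = p , q , refl , refl , e
liftAdj-true E (just p) nothing  ()
liftAdj-true E nothing  y        ()

liftAdj-just : ∀ {m} (E : Fin m → Fin m → Bool) {x y p q}
  → x ≡ just p → y ≡ just q → liftAdj E x y ≡ E p q
liftAdj-just E refl refl = refl

liftAdj-nothingˡ : ∀ {m} (E : Fin m → Fin m → Bool) {x} y → x ≡ nothing → liftAdj E x y ≡ false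
liftAdj-nothingˡ E y refl = refl

liftAdj-nothingʳ : ∀ {m} (E : Fin m → Fin m → Bool) x {y} → y ≡ nothing → liftAdj E x y ≡ false
liftAdj-nothingʳ E (just _) refl = refl
liftAdj-nothingʳ E nothing  refl = refl

liftAdj-sym : ∀ {m} (E : Fin m → Fin m → Bool) → (∀ p q → E p q ≡ E q p)
  → ∀ x y → liftAdj E x y ≡ liftAdj E y x
liftAdj-sym E E-sym (just p) (just q) = E-sym p q
liftAdj-sym E E-sym (just p) nothing  = refl
liftAdj-sym E E-sym nothing  (just q) = refl
liftAdj-sym E E-sym nothing  nothing  = refl

adj-irrefl : ∀ {n} (H : Graph n) p q → adj H p q ≡ true → ¬ p ≡ q
adj-irrefl H p .p e refl with trans (≡-sym e) (irr H p)
... | ()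

All-∷ʳ : ∀ {A : Set} {P : A → Set} {xs x} → All P xs → P x → All P (xs ∷ʳ x)
All-∷ʳ []       px = px ∷ []
All-∷ʳ (p ∷ ps) px = p ∷ All-∷ʳ ps px

Linked-map : ∀ {A B : Set} {R : A → A → Set} {R′ : B → B → Set} {P : A → Set} (f : A → B)
  → (∀ {u w} → P u → P w → R u w → R′ (f u) (f w))
  → ∀ {xs} → All P xs → Linked R xs → Linked R′ (map f xs)
Linked-map f h []             []       = []
Linked-map f h (_ ∷ [])       [-]      = [-]
Linked-map f h (pu ∷ pw ∷ ps) (r ∷ rs) = h pu pw r ∷ Linked-map f h (pw ∷ ps) rs

Distinct : ∀ {A : Set} → List A → Set
Distinct = AllPairs (λ x y → ¬ x ≡ y)

Distinct-map : ∀ {A B : Set} {P : A → Set} (f : A → B)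
  → (∀ {u w} → P u → P w → f u ≡ f w → u ≡ w)
  → ∀ {xs} → All P xs → Distinct xs → Distinct (map f xs)
Distinct-map f inj []       []       = []
Distinct-map {P = P} f inj (pu ∷ ps) (d ∷ ds) = apart pu ps d ∷ Distinct-map f inj ps ds
  where
  apart : ∀ {u xs} → P u → All P xs → All (λ y → ¬ u ≡ y) xs → All (λ y → ¬ f u ≡ y) (map f xs)
  apart pu []        []       = []
  apart pu (pw ∷ ps) (n ∷ ns) = (λ e → n (inj pu pw e)) ∷ apart pu ps ns

Reach-trans : ∀ {n} {E : Fin n → Fin n → Bool} {u v w} → Reach E u v → Reach E v w → Reach E u w
Reach-trans here       r′ = r′
Reach-trans (step e r) r′ = step e (Reach-trans r r′)

Reach-sym : ∀ {n} {E : Fin n → Fin n → Bool} → (∀ u w → E u w ≡ E w u)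
  → ∀ {u w} → Reach E u w → Reach E w u
Reach-sym E-sym here                 = here
Reach-sym E-sym (step {u} {v} e r) = Reach-trans (Reach-sym E-sym r) (step (trans (E-sym v u) e) here)

Reach-map : ∀ {n m} {E : Fin n → Fin n → Bool} {E′ : Fin m → Fin m → Bool} (f : Fin n → Fin m)
  → (∀ u w → E u w ≡ true → E′ (f u) (f w) ≡ true)
  → ∀ {u w} → Reach E u w → Reach E′ (f u) (f w)
Reach-map f h here       = here
Reach-map f h (step e r) = step (h _ _ e) (Reach-map f h r)

Reach-from-root : ∀ {n} {E : Fin n → Fin n → Bool} → (∀ u w → E u w ≡ E w u)
  → ∀ {r} → (∀ w → Reach E r w) → ∀ u w → Reach E u w
Reach-from-root E-sym from-r u w = Reach-trans (Reach-sym E-sym (from-r u)) (from-r w)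

IsTree : ∀ {n} → (Fin n → Fin n → Bool) → Set
IsTree E = Acyclic E × (∀ u w → Reach E u w)

IsTwoTree : ∀ {n} → (Fin n → Fin n → Bool) → Fin n → Fin n → Set
IsTwoTree E i j = Acyclic E × ¬ Reach E i j × (∀ u → Reach E i u ⊎ Reach E j u)

IsTwoTree-swap : ∀ {n} {E : Fin n → Fin n → Bool} → (∀ u w → E u w ≡ E w u)
  → ∀ {i j} → IsTwoTree E i j → IsTwoTree E j i
IsTwoTree-swap E-sym (ac , i↛j , cover) = ac , (λ r → i↛j (Reach-sym E-sym r)) , (λ u → ⊎-swap (cover u))

-- Fin n as the union of Fin n₁ and Fin n₂ along the single vertex c = ι₁ c₁ = ι₂ c₂;
-- π₁ and π₂ are the partial inverses of the inclusions ι₁ and ι₂.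
record Wedge (n n₁ n₂ : ℕ) : Set where
  field
    π₁    : Fin n → Maybe (Fin n₁)
    π₂    : Fin n → Maybe (Fin n₂)
    ι₁    : Fin n₁ → Fin n
    ι₂    : Fin n₂ → Fin n
    c     : Fin n
    c₁    : Fin n₁
    c₂    : Fin n₂
    π₁-ι₁ : ∀ p → π₁ (ι₁ p) ≡ just p
    π₂-ι₂ : ∀ p → π₂ (ι₂ p) ≡ just p
    ι₁-π₁ : ∀ u p → π₁ u ≡ just p → ι₁ p ≡ u
    ι₂-π₂ : ∀ u p → π₂ u ≡ just p → ι₂ p ≡ u
    π₁-c  : π₁ c ≡ just c₁
    π₂-c  : π₂ c ≡ just c₂
    π-shared : ∀ u p q → π₁ u ≡ just p → π₂ u ≡ just q → u ≡ c
    π-cover  : ∀ u → (Σ (Fin n₁) λ p → π₁ u ≡ just p) ⊎ (Σ (Fin n₂) λ q → π₂ u ≡ just q)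

Wedge-flip : ∀ {n n₁ n₂} → Wedge n n₁ n₂ → Wedge n n₂ n₁
Wedge-flip W = record
  { π₁ = π₂ ; π₂ = π₁ ; ι₁ = ι₂ ; ι₂ = ι₁ ; c = c ; c₁ = c₂ ; c₂ = c₁
  ; π₁-ι₁ = π₂-ι₂ ; π₂-ι₂ = π₁-ι₁ ; ι₁-π₁ = ι₂-π₂ ; ι₂-π₂ = ι₁-π₁ ; π₁-c = π₂-c ; π₂-c = π₁-c
  ; π-shared = λ u p q e₁ e₂ → π-shared u q p e₂ e₁
  ; π-cover  = λ u → ⊎-swap (π-cover u)
  }
  where open Wedge W

record Glued {n n₁ n₂} (W : Wedge n n₁ n₂) : Set where
  field
    E₁ : Fin n₁ → Fin n₁ → Bool
    E₂ : Fin n₂ → Fin n₂ → Bool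
    E  : Fin n → Fin n → Bool
    E-glued   : ∀ u w → E u w ≡ liftAdj E₁ (Wedge.π₁ W u) (Wedge.π₁ W w)
                              ∨ liftAdj E₂ (Wedge.π₂ W u) (Wedge.π₂ W w)
    E₁-irrefl : ∀ p q → E₁ p q ≡ true → ¬ p ≡ q
    E₂-irrefl : ∀ p q → E₂ p q ≡ true → ¬ p ≡ q
    E₁-sym    : ∀ p q → E₁ p q ≡ E₁ q p
    E₂-sym    : ∀ p q → E₂ p q ≡ E₂ q p

Glued-flip : ∀ {n n₁ n₂} {W : Wedge n n₁ n₂} → Glued W → Glued (Wedge-flip W)
Glued-flip {W = W} Γ = record
  { E₁ = E₂ ; E₂ = E₁ ; E = E
  ; E-glued   = λ u w → trans (E-glued u w) (∨-comm (liftAdj E₁ (π₁ u) (π₁ w)) _)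
  ; E₁-irrefl = E₂-irrefl ; E₂-irrefl = E₁-irrefl ; E₁-sym = E₂-sym ; E₂-sym = E₁-sym
  }
  where open Wedge W
        open Glued Γ

module Side {n n₁ n₂} {W : Wedge n n₁ n₂} (Γ : Glued W) where

  open Wedge W
  open Glued Γ

  On₁ : Fin n → Set
  On₁ u = Σ (Fin n₁) λ p → π₁ u ≡ just p

  Inner₁ : Fin n → Set
  Inner₁ u = On₁ u × ¬ u ≡ c

  side₁ : Fin n → Fin n₁
  side₁ u = fromMaybe c₁ (π₁ u)

  side₁-π₁ : ∀ u p → π₁ u ≡ just p → side₁ u ≡ p
  side₁-π₁ u p e rewrite e = refl

  ι₁-side₁ : ∀ u → On₁ u → ι₁ (side₁ u) ≡ u
  ι₁-side₁ u (p , e) rewrite side₁-π₁ u p e = ι₁-π₁ u p e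

  side₁-ι₁ : ∀ p → side₁ (ι₁ p) ≡ p
  side₁-ι₁ p = side₁-π₁ (ι₁ p) p (π₁-ι₁ p)

  side₁-c : side₁ c ≡ c₁
  side₁-c = side₁-π₁ c c₁ π₁-c

  On₁-ι₁ : ∀ p → On₁ (ι₁ p)
  On₁-ι₁ p = p , π₁-ι₁ p

  On₁-c : On₁ c
  On₁-c = c₁ , π₁-c

  side₁-injective : ∀ {u w} → On₁ u → On₁ w → side₁ u ≡ side₁ w → u ≡ w
  side₁-injective {u} {w} on-u on-w e =
    trans (≡-sym (ι₁-side₁ u on-u)) (trans (cong ι₁ e) (ι₁-side₁ w on-w))

  E₁⇒E : ∀ p q → E₁ p q ≡ true → E (ι₁ p) (ι₁ q) ≡ true
  E₁⇒E p q e rewrite E-glued (ι₁ p) (ι₁ q) | π₁-ι₁ p | π₁-ι₁ q | e = refl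

  E-split : ∀ u w → E u w ≡ true →
      (Σ (Fin n₁) λ p → Σ (Fin n₁) λ q → π₁ u ≡ just p × π₁ w ≡ just q × E₁ p q ≡ true)
    ⊎ (Σ (Fin n₂) λ p → Σ (Fin n₂) λ q → π₂ u ≡ just p × π₂ w ≡ just q × E₂ p q ≡ true)
  E-split u w e with ∨-true (trans (≡-sym (E-glued u w)) e)
  ... | inj₁ e₁ = inj₁ (liftAdj-true E₁ _ _ e₁)
  ... | inj₂ e₂ = inj₂ (liftAdj-true E₂ _ _ e₂)

  E-from-inner₁ : ∀ {u w} → Inner₁ u → E u w ≡ true → On₁ w
  E-from-inner₁ {u} {w} ((p , eu) , u≢c) e with E-split u w e
  ... | inj₁ (_ , q , _ , ew , _) = q , ew
  ... | inj₂ (p′ , _ , eu′ , _ , _) = ⊥-elim (u≢c (π-shared u p p′ eu eu′))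

  E-to-inner₁ : ∀ {u w} → Inner₁ w → E u w ≡ true → On₁ u
  E-to-inner₁ {u} {w} ((q , ew) , w≢c) e with E-split u w e
  ... | inj₁ (p , _ , eu , _ , _) = p , eu
  ... | inj₂ (_ , q′ , _ , ew′ , _) = ⊥-elim (w≢c (π-shared w q q′ ew ew′))

  -- Both ends on side 1 means any E₂-edge between them would be the loop c–c.
  E⇒E₁ : ∀ {u w} → On₁ u → On₁ w → E u w ≡ true → E₁ (side₁ u) (side₁ w) ≡ true
  E⇒E₁ {u} {w} (p₀ , eu₀) (q₀ , ew₀) e with E-split u w e
  ... | inj₁ (p , q , eu , ew , e₁) rewrite side₁-π₁ u p eu | side₁-π₁ w q ew = e₁
  ... | inj₂ (p , q , eu , ew , e₂) =
    ⊥-elim (E₂-irrefl p q e₂ (just-injective (trans (≡-sym eu) (trans (cong π₂ u≡w) ew))))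
    where
    u≡w : u ≡ w
    u≡w = trans (π-shared u p₀ p eu₀ eu) (≡-sym (π-shared w q₀ q ew₀ ew))

  Reach-ι₁ : ∀ {p q} → Reach E₁ p q → Reach E (ι₁ p) (ι₁ q)
  Reach-ι₁ = Reach-map ι₁ E₁⇒E

  Cycle₁⇒Cycle : Cycle E₁ → Cycle E
  Cycle₁⇒Cycle (x , ys , len , distinct , linked) =
      ι₁ x , map ι₁ ys , subst (2 ≤_) (≡-sym (length-map ι₁ ys)) len
    , Distinct-map {P = λ _ → ⊤} ι₁ (λ {u} {w} _ _ e → trans (≡-sym (side₁-ι₁ u)) (trans (cong side₁ e) (side₁-ι₁ w)))
        (all-⊤ (x ∷ ys)) distinct
    , subst (Linked (λ u v → E u v ≡ true)) (map-++ ι₁ (x ∷ ys) (x ∷ []))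
        (Linked-map {P = λ _ → ⊤} ι₁ (λ {u} {w} _ _ e → E₁⇒E u w e) (all-⊤ _) linked)
    where
    all-⊤ : ∀ (xs : List (Fin n₁)) → All (λ _ → ⊤) xs
    all-⊤ []       = []
    all-⊤ (_ ∷ xs) = tt ∷ all-⊤ xs

  Cycle-on₁⇒Cycle₁ : ∀ x ys → 2 ≤ length ys → Distinct (x ∷ ys)
    → Linked (λ u v → E u v ≡ true) ((x ∷ ys) ∷ʳ x)
    → All On₁ (x ∷ ys) → Cycle E₁
  Cycle-on₁⇒Cycle₁ x ys len distinct linked on@(on-x ∷ _) =
      side₁ x , map side₁ ys , subst (2 ≤_) (≡-sym (length-map side₁ ys)) len
    , Distinct-map side₁ side₁-injective on distinct
    , subst (Linked (λ u v → E₁ u v ≡ true)) (map-++ side₁ (x ∷ ys) (x ∷ []))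
        (Linked-map side₁ E⇒E₁ (All-∷ʳ on on-x) linked)

  private
    E-Path : List (Fin n) → Set
    E-Path = Linked (λ u v → E u v ≡ true)

    avoid-c : ∀ {ys} → All (λ y → ¬ c ≡ y) ys → All (λ y → ¬ y ≡ c) ys
    avoid-c []       = []
    avoid-c (p ∷ ps) = (λ e → p (≡-sym e)) ∷ avoid-c ps

    path-from-inner₁ : ∀ {z zs w} → Inner₁ z → All (λ y → ¬ y ≡ c) zs → E-Path (z ∷ zs ∷ʳ w) → All On₁ zs
    path-from-inner₁ inner []           _        = []
    path-from-inner₁ inner (y≢c ∷ y≢cs) (e ∷ ps) =
      let on-y = E-from-inner₁ inner e in on-y ∷ path-from-inner₁ (on-y , y≢c) y≢cs ps

    path-to-inner₁ : ∀ {zs x} → Inner₁ x → All (λ y → ¬ y ≡ c) zs → E-Path (zs ∷ʳ x) → All On₁ zs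
    path-to-inner₁ inner [] _ = []
    path-to-inner₁ {z ∷ []} inner (_ ∷ []) (e ∷ _) = E-to-inner₁ inner e ∷ []
    path-to-inner₁ {z ∷ z′ ∷ zs} inner (_ ∷ z′≢c ∷ rest) (e ∷ ps)
      with path-to-inner₁ inner (z′≢c ∷ rest) ps
    ... | on-z′ ∷ on-rest = E-to-inner₁ (on-z′ , z′≢c) e ∷ on-z′ ∷ on-rest

    -- A path between inner vertices of side 1 can only leave side 1 after passing through c,
    -- and, being simple, it passes through c at most once.
    path-between-inner₁ : ∀ {z zs x} → Inner₁ z → Inner₁ x → Distinct zs → E-Path (z ∷ zs ∷ʳ x) → All On₁ zs
    path-between-inner₁ inner-z inner-x [] _ = []
    path-between-inner₁ {zs = y ∷ zs} inner-z inner-x (y≢zs ∷ distinct) (e ∷ ps) with y ≟ c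
    ... | no y≢c = let on-y = E-from-inner₁ inner-z e in
                   on-y ∷ path-between-inner₁ (on-y , y≢c) inner-x distinct ps
    ... | yes refl = On₁-c ∷ path-to-inner₁ inner-x (avoid-c y≢zs) (drop-head ps)
      where
      drop-head : ∀ {y ys} → E-Path (y ∷ ys) → E-Path ys
      drop-head [-]      = []
      drop-head (_ ∷ ps) = ps

  Cycle-at-inner₁⇒Cycle₁ : ∀ x ys → 2 ≤ length ys → Distinct (x ∷ ys)
    → E-Path ((x ∷ ys) ∷ʳ x) → Inner₁ x → Cycle E₁
  Cycle-at-inner₁⇒Cycle₁ x ys len distinct@(_ ∷ distinct-ys) linked inner =
    Cycle-on₁⇒Cycle₁ x ys len distinct linked
      (proj₁ inner ∷ path-between-inner₁ inner inner distinct-ys linked)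

  Cycle-at-c⇒Cycle₁ : ∀ y ys → 2 ≤ length (y ∷ ys) → Distinct (c ∷ y ∷ ys)
    → E-Path ((c ∷ y ∷ ys) ∷ʳ c) → Inner₁ y → Cycle E₁
  Cycle-at-c⇒Cycle₁ y ys len distinct@((_ ∷ c≢ys) ∷ _) linked@(_ ∷ ps) inner =
    Cycle-on₁⇒Cycle₁ c (y ∷ ys) len distinct linked
      (On₁-c ∷ proj₁ inner ∷ path-from-inner₁ inner (avoid-c c≢ys) ps)

module Gluing₁ {n n₁ n₂} {W : Wedge n n₁ n₂} (Γ : Glued W) where

  open Wedge W
  open Glued Γ
  module S₁ = Side Γ
  module S₂ = Side (Glued-flip Γ)
  open S₁ using (On₁; Inner₁; side₁)
  open S₂ using () renaming (On₁ to On₂; Inner₁ to Inner₂; side₁ to side₂)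

  E-sym : ∀ u w → E u w ≡ E w u
  E-sym u w rewrite E-glued u w | E-glued w u
                  | liftAdj-sym E₁ E₁-sym (π₁ u) (π₁ w) | liftAdj-sym E₂ E₂-sym (π₂ u) (π₂ w) = refl

  on-both⇒c : ∀ {u} → On₁ u → On₂ u → u ≡ c
  on-both⇒c {u} (p , e₁) (q , e₂) = π-shared u p q e₁ e₂

  Acyclic-glue : Acyclic E₁ → Acyclic E₂ → Acyclic E
  Acyclic-glue ac₁ ac₂ (x , ys , len , distinct , linked) with x ≟ c
  Acyclic-glue ac₁ ac₂ (x , ys , len , distinct , linked) | no x≢c with π-cover x
  ... | inj₁ on = ac₁ (S₁.Cycle-at-inner₁⇒Cycle₁ x ys len distinct linked (on , x≢c))
  ... | inj₂ on = ac₂ (S₂.Cycle-at-inner₁⇒Cycle₁ x ys len distinct linked (on , x≢c))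
  Acyclic-glue ac₁ ac₂ (x , y ∷ ys , len , distinct@((c≢y ∷ _) ∷ _) , linked) | yes refl with π-cover y
  ... | inj₁ on = ac₁ (S₁.Cycle-at-c⇒Cycle₁ y ys len distinct linked (on , λ e → c≢y (≡-sym e)))
  ... | inj₂ on = ac₂ (S₂.Cycle-at-c⇒Cycle₁ y ys len distinct linked (on , λ e → c≢y (≡-sym e)))

  Acyclic⇒Acyclic₁ : Acyclic E → Acyclic E₁
  Acyclic⇒Acyclic₁ ac cyc = ac (S₁.Cycle₁⇒Cycle cyc)

  Acyclic⇒Acyclic₂ : Acyclic E → Acyclic E₂
  Acyclic⇒Acyclic₂ ac cyc = ac (S₂.Cycle₁⇒Cycle cyc)

  Reach₁ : Fin n → Fin n → Set
  Reach₁ u w = Reach E₁ (side₁ u) (side₁ w)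

  Reach₂ : Fin n → Fin n → Set
  Reach₂ u w = Reach E₂ (side₂ u) (side₂ w)

  record Shadow (u w : Fin n) : Set where
    field
      within₁  : On₁ u → On₁ w → Reach₁ u w
      within₂  : On₂ u → On₂ w → Reach₂ u w
      across₁₂ : On₁ u → On₂ w → Reach₁ u c × Reach₂ c w
      across₂₁ : On₂ u → On₁ w → Reach₂ u c × Reach₁ c w
  open Shadow

  -- A walk in E splits at its visits to c into walks inside the two sides.
  shadow : ∀ {u w} → Reach E u w → Shadow u w
  shadow {u} here = record
    { within₁  = λ _ _ → here
    ; within₂  = λ _ _ → here
    ; across₁₂ = λ on₁ on₂ → let u≡c = on-both⇒c on₁ on₂ in
        subst (λ z → Reach₁ z c) (≡-sym u≡c) here , subst (Reach₂ c) (≡-sym u≡c) here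
    ; across₂₁ = λ on₂ on₁ → let u≡c = on-both⇒c on₁ on₂ in
        subst (λ z → Reach₂ z c) (≡-sym u≡c) here , subst (Reach₁ c) (≡-sym u≡c) here
    }
  shadow {u} {w} (step {v = u′} e r) with shadow r | S₁.E-split u u′ e
  ... | sh | inj₁ (p , q , eu , eu′ , e₁) = record
    { within₁  = λ _ on-w → step e₁′ (within₁ sh on-u′ on-w)
    ; within₂  = λ on₂ on₂-w → from-c (proj₂ (across₁₂ sh on-u′ on₂-w)) (on-both⇒c on-u on₂)
    ; across₁₂ = λ _ on₂-w → let (r₁ , r₂) = across₁₂ sh on-u′ on₂-w in step e₁′ r₁ , r₂
    ; across₂₁ = λ on₂ on-w → let u≡c = on-both⇒c on-u on₂ in
        subst (λ z → Reach₂ z c) (≡-sym u≡c) here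
      , subst (λ z → Reach₁ z w) u≡c (step e₁′ (within₁ sh on-u′ on-w))
    }
    where
    on-u : On₁ u
    on-u = p , eu
    on-u′ : On₁ u′
    on-u′ = q , eu′
    e₁′ : E₁ (side₁ u) (side₁ u′) ≡ true
    e₁′ rewrite S₁.side₁-π₁ u p eu | S₁.side₁-π₁ u′ q eu′ = e₁
    from-c : Reach₂ c w → u ≡ c → Reach₂ u w
    from-c r₂ refl = r₂
  ... | sh | inj₂ (p , q , eu , eu′ , e₂) = record
    { within₁  = λ on₁ on₁-w → from-c (proj₂ (across₂₁ sh on-u′ on₁-w)) (on-both⇒c on₁ on-u)
    ; within₂  = λ _ on-w → step e₂′ (within₂ sh on-u′ on-w)
    ; across₁₂ = λ on₁ on-w → let u≡c = on-both⇒c on₁ on-u in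
        subst (λ z → Reach₁ z c) (≡-sym u≡c) here
      , subst (λ z → Reach₂ z w) u≡c (step e₂′ (within₂ sh on-u′ on-w))
    ; across₂₁ = λ _ on₁-w → let (r₂ , r₁) = across₂₁ sh on-u′ on₁-w in step e₂′ r₂ , r₁
    }
    where
    on-u : On₂ u
    on-u = p , eu
    on-u′ : On₂ u′
    on-u′ = q , eu′
    e₂′ : E₂ (side₂ u) (side₂ u′) ≡ true
    e₂′ rewrite S₂.side₁-π₁ u p eu | S₂.side₁-π₁ u′ q eu′ = e₂
    from-c : Reach₁ c w → u ≡ c → Reach₁ u w
    from-c r₁ refl = r₁

  Reach₁⇒Reach : ∀ {u w} → On₁ u → On₁ w → Reach₁ u w → Reach E u w
  Reach₁⇒Reach {u} {w} on-u on-w r =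
    subst₂ (Reach E) (S₁.ι₁-side₁ u on-u) (S₁.ι₁-side₁ w on-w) (S₁.Reach-ι₁ r)

  Reach₂⇒Reach : ∀ {u w} → On₂ u → On₂ w → Reach₂ u w → Reach E u w
  Reach₂⇒Reach {u} {w} on-u on-w r =
    subst₂ (Reach E) (S₂.ι₁-side₁ u on-u) (S₂.ι₁-side₁ w on-w) (S₂.Reach-ι₁ r)

  Reach⇒Reach₁ : ∀ {p q} → Reach E (ι₁ p) (ι₁ q) → Reach E₁ p q
  Reach⇒Reach₁ {p} {q} r =
    subst₂ (Reach E₁) (S₁.side₁-ι₁ p) (S₁.side₁-ι₁ q) (within₁ (shadow r) (S₁.On₁-ι₁ p) (S₁.On₁-ι₁ q))

  Reach⇒Reach₂ : ∀ {p q} → Reach E (ι₂ p) (ι₂ q) → Reach E₂ p q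
  Reach⇒Reach₂ {p} {q} r =
    subst₂ (Reach E₂) (S₂.side₁-ι₁ p) (S₂.side₁-ι₁ q) (within₂ (shadow r) (S₂.On₁-ι₁ p) (S₂.On₁-ι₁ q))

  Reach₁-to-c⇒Reach : ∀ {u} → On₁ u → Reach E₁ (side₁ u) c₁ → Reach E u c
  Reach₁-to-c⇒Reach {u} on-u r = Reach₁⇒Reach on-u S₁.On₁-c (subst (Reach E₁ (side₁ u)) (≡-sym S₁.side₁-c) r)

  Reach₂-from-c⇒Reach : ∀ {w} → On₂ w → Reach E₂ c₂ (side₂ w) → Reach E c w
  Reach₂-from-c⇒Reach {w} on-w r =
    Reach₂⇒Reach S₂.On₁-c on-w (subst (λ z → Reach E₂ z (side₂ w)) (≡-sym S₂.side₁-c) r)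

  Reach-across⇒Reach₂-from-c : ∀ {u q} → On₁ u → Reach E u (ι₂ q) → Reach E₂ c₂ q
  Reach-across⇒Reach₂-from-c {u} {q} on-u r =
    subst₂ (Reach E₂) S₂.side₁-c (S₂.side₁-ι₁ q) (proj₂ (across₁₂ (shadow r) on-u (S₂.On₁-ι₁ q)))

  connected-glue : (∀ p q → Reach E₁ p q) → (∀ p q → Reach E₂ p q) → ∀ u w → Reach E u w
  connected-glue conn₁ conn₂ u w with π-cover u | π-cover w
  ... | inj₁ on-u | inj₁ on-w = Reach₁⇒Reach on-u on-w (conn₁ _ _)
  ... | inj₂ on-u | inj₂ on-w = Reach₂⇒Reach on-u on-w (conn₂ _ _)
  ... | inj₁ on-u | inj₂ on-w =
    Reach-trans (Reach₁⇒Reach on-u S₁.On₁-c (conn₁ _ _)) (Reach₂⇒Reach S₂.On₁-c on-w (conn₂ _ _))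
  ... | inj₂ on-u | inj₁ on-w =
    Reach-trans (Reach₂⇒Reach on-u S₂.On₁-c (conn₂ _ _)) (Reach₁⇒Reach S₁.On₁-c on-w (conn₁ _ _))

  IsTree-split : IsTree E → IsTree E₁ × IsTree E₂
  IsTree-split (ac , conn) =
      (Acyclic⇒Acyclic₁ ac , λ p q → Reach⇒Reach₁ (conn _ _))
    , (Acyclic⇒Acyclic₂ ac , λ p q → Reach⇒Reach₂ (conn _ _))

  IsTree-glue : IsTree E₁ → IsTree E₂ → IsTree E
  IsTree-glue (ac₁ , conn₁) (ac₂ , conn₂) = Acyclic-glue ac₁ ac₂ , connected-glue conn₁ conn₂

  IsTwoTree-within₁-split : ∀ {u w} → On₁ u → On₁ w → IsTwoTree E u w
    → IsTwoTree E₁ (side₁ u) (side₁ w) × IsTree E₂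
  IsTwoTree-within₁-split {u} {w} on-u on-w (ac , u↛w , cover) =
      (Acyclic⇒Acyclic₁ ac , (λ r → u↛w (Reach₁⇒Reach on-u on-w r)) , cover₁)
    , (Acyclic⇒Acyclic₂ ac , Reach-from-root E₂-sym from-c₂)
    where
    cover₁ : ∀ p → Reach E₁ (side₁ u) p ⊎ Reach E₁ (side₁ w) p
    cover₁ p with cover (ι₁ p)
    ... | inj₁ r = inj₁ (subst (Reach E₁ _) (S₁.side₁-ι₁ p) (within₁ (shadow r) on-u (S₁.On₁-ι₁ p)))
    ... | inj₂ r = inj₂ (subst (Reach E₁ _) (S₁.side₁-ι₁ p) (within₁ (shadow r) on-w (S₁.On₁-ι₁ p)))
    from-c₂ : ∀ q → Reach E₂ c₂ q
    from-c₂ q with cover (ι₂ q)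
    ... | inj₁ r = Reach-across⇒Reach₂-from-c on-u r
    ... | inj₂ r = Reach-across⇒Reach₂-from-c on-w r

  IsTwoTree-within₁-glue : ∀ {u w} → On₁ u → On₁ w
    → IsTwoTree E₁ (side₁ u) (side₁ w) → IsTree E₂ → IsTwoTree E u w
  IsTwoTree-within₁-glue {u} {w} on-u on-w (ac₁ , u↛w , cover₁) (ac₂ , conn₂) =
    Acyclic-glue ac₁ ac₂ , (λ r → u↛w (within₁ (shadow r) on-u on-w)) , cover
    where
    cover : ∀ x → Reach E u x ⊎ Reach E w x
    cover x with π-cover x
    ... | inj₁ on-x with cover₁ (side₁ x)
    ...   | inj₁ r = inj₁ (Reach₁⇒Reach on-u on-x r)
    ...   | inj₂ r = inj₂ (Reach₁⇒Reach on-w on-x r)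
    cover x | inj₂ on-x with cover₁ c₁
    ...   | inj₁ r = inj₁ (Reach-trans (Reach₁-to-c⇒Reach on-u r) (Reach₂-from-c⇒Reach on-x (conn₂ _ _)))
    ...   | inj₂ r = inj₂ (Reach-trans (Reach₁-to-c⇒Reach on-w r) (Reach₂-from-c⇒Reach on-x (conn₂ _ _)))

  IsTwoTree-across-split-c∼u : ∀ {u w} → On₁ u → Inner₂ w → IsTwoTree E u w → Reach E u c
    → IsTree E₁ × IsTwoTree E₂ c₂ (side₂ w)
  IsTwoTree-across-split-c∼u {u} {w} on-u (on-w , w≢c) (ac , u↛w , cover) u→c =
    (Acyclic⇒Acyclic₁ ac , Reach-from-root E₁-sym from-c₁) , (Acyclic⇒Acyclic₂ ac , c↛w₂ , cover₂)
    where
    w↛c : ¬ Reach E w c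
    w↛c r = u↛w (Reach-trans u→c (Reach-sym E-sym r))
    from-c₁ : ∀ p → Reach E₁ c₁ p
    from-c₁ p with cover (ι₁ p)
    ... | inj₁ r = subst₂ (Reach E₁) S₁.side₁-c (S₁.side₁-ι₁ p)
                     (within₁ (shadow (Reach-trans (Reach-sym E-sym u→c) r)) S₁.On₁-c (S₁.On₁-ι₁ p))
    ... | inj₂ r = ⊥-elim (w↛c (Reach₂⇒Reach on-w S₂.On₁-c (proj₁ (across₂₁ (shadow r) on-w (S₁.On₁-ι₁ p)))))
    c↛w₂ : ¬ Reach E₂ c₂ (side₂ w)
    c↛w₂ r = w↛c (Reach-sym E-sym (Reach₂-from-c⇒Reach on-w r))
    cover₂ : ∀ q → Reach E₂ c₂ q ⊎ Reach E₂ (side₂ w) q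
    cover₂ q with cover (ι₂ q)
    ... | inj₁ r = inj₁ (Reach-across⇒Reach₂-from-c on-u r)
    ... | inj₂ r = inj₂ (subst (Reach E₂ _) (S₂.side₁-ι₁ q) (within₂ (shadow r) on-w (S₂.On₁-ι₁ q)))

  IsTwoTree-across-glue-c∼u : ∀ {u w} → On₁ u → On₂ w → IsTree E₁ → IsTwoTree E₂ c₂ (side₂ w) → IsTwoTree E u w
  IsTwoTree-across-glue-c∼u {u} {w} on-u on-w (ac₁ , conn₁) (ac₂ , c↛w₂ , cover₂) =
    Acyclic-glue ac₁ ac₂ , u↛w , cover
    where
    u↛w : ¬ Reach E u w
    u↛w r = c↛w₂ (subst (λ z → Reach E₂ z (side₂ w)) S₂.side₁-c (proj₂ (across₁₂ (shadow r) on-u on-w)))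
    cover : ∀ x → Reach E u x ⊎ Reach E w x
    cover x with π-cover x
    ... | inj₁ on-x = inj₁ (Reach₁⇒Reach on-u on-x (conn₁ _ _))
    ... | inj₂ on-x with cover₂ (side₂ x)
    ...   | inj₁ r = inj₁ (Reach-trans (Reach₁-to-c⇒Reach on-u (conn₁ _ _)) (Reach₂-from-c⇒Reach on-x r))
    ...   | inj₂ r = inj₂ (Reach₂⇒Reach on-w on-x r)

module Gluing {n n₁ n₂} {W : Wedge n n₁ n₂} (Γ : Glued W) where

  open Wedge W
  open Glued Γ
  private
    module G₁ = Gluing₁ Γ
    module G₂ = Gluing₁ (Glued-flip Γ)
  open Side Γ public using (On₁; Inner₁; side₁)
  open Side (Glued-flip Γ) public using () renaming (On₁ to On₂; Inner₁ to Inner₂; side₁ to side₂)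
  open G₁ public using (E-sym; IsTree-split; IsTree-glue; IsTwoTree-within₁-split; IsTwoTree-within₁-glue)
  open G₂ public using ()
    renaming (IsTwoTree-within₁-split to IsTwoTree-within₂-split; IsTwoTree-within₁-glue to IsTwoTree-within₂-glue)

  -- The cut vertex c lies in the tree of exactly one of u and w.
  IsTwoTree-across-split : ∀ {u w} → Inner₁ u → Inner₂ w → IsTwoTree E u w
    → (IsTwoTree E₁ (side₁ u) c₁ × IsTree E₂) ⊎ (IsTree E₁ × IsTwoTree E₂ c₂ (side₂ w))
  IsTwoTree-across-split inner-u inner-w t with proj₂ (proj₂ t) c
  ... | inj₁ u→c = inj₂ (G₁.IsTwoTree-across-split-c∼u (proj₁ inner-u) inner-w t u→c)
  ... | inj₂ w→c with G₂.IsTwoTree-across-split-c∼u (proj₁ inner-w) inner-u (IsTwoTree-swap E-sym t) w→c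
  ...   | tree₂ , two-tree₁ = inj₁ (IsTwoTree-swap E₁-sym two-tree₁ , tree₂)

  IsTwoTree-across-glue : ∀ {u w} → On₁ u → On₂ w
    → (IsTwoTree E₁ (side₁ u) c₁ × IsTree E₂) ⊎ (IsTree E₁ × IsTwoTree E₂ c₂ (side₂ w)) → IsTwoTree E u w
  IsTwoTree-across-glue on-u on-w (inj₂ (tree₁ , two-tree₂)) = G₁.IsTwoTree-across-glue-c∼u on-u on-w tree₁ two-tree₂
  IsTwoTree-across-glue on-u on-w (inj₁ (two-tree₁ , tree₂)) =
    IsTwoTree-swap E-sym (G₂.IsTwoTree-across-glue-c∼u on-w on-u tree₂ (IsTwoTree-swap E₁-sym two-tree₁))

indicator : ∀ {A : Set} → Dec A → ℕ
indicator (yes _) = 1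
indicator (no _)  = 0

indicator≢0 : ∀ {A : Set} (A? : Dec A) → ¬ indicator A? ≡ 0 → A
indicator≢0 (yes a) _   = a
indicator≢0 (no _)  ≢0 = ⊥-elim (≢0 refl)

indicator-cong : ∀ {A B : Set} → (A → B) → (B → A) → (A? : Dec A) (B? : Dec B) → indicator A? ≡ indicator B?
indicator-cong f g (yes _) (yes _) = refl
indicator-cong f g (yes a) (no ¬b) = ⊥-elim (¬b (f a))
indicator-cong f g (no ¬a) (yes b) = ⊥-elim (¬a (g b))
indicator-cong f g (no _)  (no _)  = refl

indicator-× : ∀ {A B : Set} (A? : Dec A) (B? : Dec B) → indicator (A? ×-dec B?) ≡ indicator A? * indicator B?
indicator-× (yes _) (yes _) = refl
indicator-× (yes _) (no _)  = refl
indicator-× (no _)  _       = refl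

indicator-⊎ : ∀ {A B : Set} (A? : Dec A) (B? : Dec B) → (A → B → ⊥)
  → indicator (A? ⊎-dec B?) ≡ indicator A? + indicator B?
indicator-⊎ (yes a) (yes b) excl = ⊥-elim (excl a b)
indicator-⊎ (yes _) (no _)  _    = refl
indicator-⊎ (no _)  (yes _) _    = refl
indicator-⊎ (no _)  (no _)  _    = refl

sumOver : ∀ {A : Set} → List A → (A → ℕ) → ℕ
sumOver []       f = 0
sumOver (x ∷ xs) f = f x + sumOver xs f

sumOver-cong : ∀ {A : Set} (xs : List A) {f g : A → ℕ} → (∀ x → f x ≡ g x) → sumOver xs f ≡ sumOver xs g
sumOver-cong []       h = refl
sumOver-cong (x ∷ xs) h = cong₂ _+_ (h x) (sumOver-cong xs h)

sumOver-+ : ∀ {A : Set} (xs : List A) (f g : A → ℕ) → sumOver xs (λ x → f x + g x) ≡ sumOver xs f + sumOver xs g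
sumOver-+ []       f g = refl
sumOver-+ (x ∷ xs) f g rewrite sumOver-+ xs f g =
  interchange +-commutativeSemigroup (f x) (g x) (sumOver xs f) (sumOver xs g)

sumOver-*ˡ : ∀ {A : Set} (xs : List A) (k : ℕ) (f : A → ℕ) → sumOver xs (λ x → k * f x) ≡ k * sumOver xs f
sumOver-*ˡ []       k f = ≡-sym (*-zeroʳ k)
sumOver-*ˡ (x ∷ xs) k f rewrite sumOver-*ˡ xs k f = ≡-sym (*-distribˡ-+ k (f x) _)

sumOver-*ʳ : ∀ {A : Set} (xs : List A) (k : ℕ) (f : A → ℕ) → sumOver xs (λ x → f x * k) ≡ sumOver xs f * k
sumOver-*ʳ xs k f = trans (sumOver-cong xs (λ x → *-comm (f x) k)) (trans (sumOver-*ˡ xs k f) (*-comm k _))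

sumOver-zero : ∀ {A : Set} (xs : List A) → sumOver xs (λ _ → 0) ≡ 0
sumOver-zero []       = refl
sumOver-zero (_ ∷ xs) = sumOver-zero xs

sumOver-swap : ∀ {A B : Set} (xs : List A) (ys : List B) (f : A → B → ℕ)
  → sumOver xs (λ x → sumOver ys (f x)) ≡ sumOver ys (λ y → sumOver xs (λ x → f x y))
sumOver-swap []       ys f = ≡-sym (sumOver-zero ys)
sumOver-swap (x ∷ xs) ys f rewrite sumOver-swap xs ys f = ≡-sym (sumOver-+ ys (f x) (λ y → sumOver xs (λ x′ → f x′ y)))

sumOver-product : ∀ {A B : Set} (xs : List A) (ys : List B) (f : A → ℕ) (g : B → ℕ)
  → sumOver xs (λ x → sumOver ys (λ y → f x * g y)) ≡ sumOver xs f * sumOver ys g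
sumOver-product xs ys f g = trans (sumOver-cong xs (λ x → sumOver-*ˡ ys (f x) g)) (sumOver-*ʳ xs (sumOver ys g) f)

sumOver-++ : ∀ {A : Set} (xs ys : List A) (f : A → ℕ) → sumOver (xs ++ ys) f ≡ sumOver xs f + sumOver ys f
sumOver-++ []       ys f = refl
sumOver-++ (x ∷ xs) ys f rewrite sumOver-++ xs ys f = ≡-sym (+-assoc (f x) _ _)

sumOver-map : ∀ {A B : Set} (h : A → B) (xs : List A) (f : B → ℕ) → sumOver (map h xs) f ≡ sumOver xs (λ x → f (h x))
sumOver-map h []       f = refl
sumOver-map h (x ∷ xs) f rewrite sumOver-map h xs f = refl

sumOver-concatMap : ∀ {A B : Set} (h : A → List B) (xs : List A) (f : B → ℕ)
  → sumOver (concatMap h xs) f ≡ sumOver xs (λ x → sumOver (h x) f)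
sumOver-concatMap h []       f = refl
sumOver-concatMap h (x ∷ xs) f =
  trans (sumOver-++ (h x) (concatMap h xs) f) (cong (sumOver (h x) f +_) (sumOver-concatMap h xs f))

Enumerates : ∀ {A : Set} → DecidableEquality A → List A → Set
Enumerates {A} _≟ᴬ_ xs = ∀ (t : A) → sumOver xs (λ x → indicator (x ≟ᴬ t)) ≡ 1

Enumerates⇒∈ : ∀ {A : Set} (_≟ᴬ_ : DecidableEquality A) (xs : List A) → Enumerates _≟ᴬ_ xs → ∀ t → t ∈ xs
Enumerates⇒∈ _≟ᴬ_ xs enum t = go xs (enum t)
  where
  go : ∀ xs → sumOver xs (λ x → indicator (x ≟ᴬ t)) ≡ 1 → t ∈ xs
  go (x ∷ xs) e with x ≟ᴬ t
  ... | yes refl = here refl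
  ... | no _     = there (go xs e)

allVecs-enumerates : ∀ {A : Set} (_≟ᴬ_ : DecidableEquality A) (xs : List A) → Enumerates _≟ᴬ_ xs
  → ∀ k → Enumerates (≡-dec {n = k} _≟ᴬ_) (allVecs k xs)
allVecs-enumerates _≟ᴬ_ xs enum zero    [] = refl
allVecs-enumerates _≟ᴬ_ xs enum (suc k) (t ∷ ts) =
  begin
    sumOver (concatMap (λ x → map (x ∷_) (allVecs k xs)) xs) (λ v → indicator (≡-dec _≟ᴬ_ v (t ∷ ts)))
  ≡⟨ sumOver-concatMap _ xs _ ⟩
    sumOver xs (λ x → sumOver (map (x ∷_) (allVecs k xs)) (λ v → indicator (≡-dec _≟ᴬ_ v (t ∷ ts))))
  ≡⟨ sumOver-cong xs (λ x → trans (sumOver-map (x ∷_) (allVecs k xs) _)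
                                  (sumOver-cong (allVecs k xs) (indicator-∷ x))) ⟩
    sumOver xs (λ x → sumOver (allVecs k xs) (λ v → indicator (x ≟ᴬ t) * indicator (≡-dec _≟ᴬ_ v ts)))
  ≡⟨ sumOver-cong xs (λ x → trans (sumOver-*ˡ (allVecs k xs) (indicator (x ≟ᴬ t)) _)
       (trans (cong (indicator (x ≟ᴬ t) *_) (allVecs-enumerates _≟ᴬ_ xs enum k ts)) (*-identityʳ _))) ⟩
    sumOver xs (λ x → indicator (x ≟ᴬ t))
  ≡⟨ enum t ⟩
    1
  ∎
  where
  open ≡-Reasoning
  indicator-∷ : ∀ x v → indicator (≡-dec _≟ᴬ_ (x ∷ v) (t ∷ ts)) ≡ indicator (x ≟ᴬ t) * indicator (≡-dec _≟ᴬ_ v ts)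
  indicator-∷ x v with x ≟ᴬ t | ≡-dec _≟ᴬ_ v ts | ≡-dec _≟ᴬ_ (x ∷ v) (t ∷ ts)
  ... | yes refl | yes refl | yes _    = refl
  ... | yes refl | yes refl | no ne    = ⊥-elim (ne refl)
  ... | yes _    | no v≢ts  | yes refl = ⊥-elim (v≢ts refl)
  ... | yes _    | no _     | no _     = refl
  ... | no x≢t   | _        | yes refl = ⊥-elim (x≢t refl)
  ... | no _     | _        | no _     = refl

Count≡sumOver : ∀ {A : Set} {P : A → Set} {xs k} → Count P xs k → (P? : ∀ x → Dec (P x))
  → k ≡ sumOver xs (λ x → indicator (P? x))
Count≡sumOver nil P? = refl
Count≡sumOver {xs = x ∷ _} (counted p c) P? with P? x
... | yes _ = cong suc (Count≡sumOver c P?)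
... | no ¬p = ⊥-elim (¬p p)
Count≡sumOver {xs = x ∷ _} (skipped ¬p c) P? with P? x
... | yes p = ⊥-elim (¬p p)
... | no _  = Count≡sumOver c P?

sumOver-indicator-× : ∀ {A B : Set} {P : A → Set} {Q : B → Set} {xs ys k₁ k₂}
  → Count P xs k₁ → Count Q ys k₂ → (P? : ∀ x → Dec (P x)) (Q? : ∀ y → Dec (Q y))
  → sumOver xs (λ x → sumOver ys (λ y → indicator (P? x ×-dec Q? y))) ≡ k₁ * k₂
sumOver-indicator-× {xs = xs} {ys} count-P count-Q P? Q? =
  trans (sumOver-cong xs (λ x → sumOver-cong ys (λ y → indicator-× (P? x) (Q? y))))
    (trans (sumOver-product xs ys _ _) (≡-sym (cong₂ _*_ (Count≡sumOver count-P P?) (Count≡sumOver count-Q Q?))))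

Count-dec : ∀ {A : Set} {P : A → Set} {xs k} → Count P xs k → ∀ {x} → x ∈ xs → Dec (P x)
Count-dec (counted p _)  (here refl) = yes p
Count-dec (skipped ¬p _) (here refl) = no ¬p
Count-dec (counted _ c)  (there m)   = Count-dec c m
Count-dec (skipped _ c)  (there m)   = Count-dec c m

Count-unique : ∀ {A : Set} {P Q : A → Set} {xs k k′} → Count P xs k → Count Q xs k′
  → (∀ x → P x → Q x) → (∀ x → Q x → P x) → k ≡ k′
Count-unique nil             nil             f g = refl
Count-unique (counted p c)   (counted q c′)  f g = cong suc (Count-unique c c′ f g)
Count-unique (counted p c)   (skipped ¬q c′) f g = ⊥-elim (¬q (f _ p))
Count-unique (skipped ¬p c)  (counted q c′)  f g = ⊥-elim (¬p (g _ q))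
Count-unique (skipped ¬p c)  (skipped ¬q c′) f g = Count-unique c c′ f g

Count-none : ∀ {A : Set} {P : A → Set} {xs k} → Count P xs k → (∀ x → ¬ P x) → k ≡ 0
Count-none nil           f = refl
Count-none (counted p c) f = ⊥-elim (f _ p)
Count-none (skipped _ c) f = Count-none c f

-- Counting elements of A by their images under a pair of retractions r₁, r₂ of glue.
module CountByParts {A B₁ B₂ : Set} (_≟ᴬ_ : DecidableEquality A)
  (_≟₁_ : DecidableEquality B₁) (_≟₂_ : DecidableEquality B₂)
  (LA : List A) (L₁ : List B₁) (L₂ : List B₂)
  (enumA : Enumerates _≟ᴬ_ LA) (enum₁ : Enumerates _≟₁_ L₁) (enum₂ : Enumerates _≟₂_ L₂)
  (glue : B₁ → B₂ → A) (r₁ : A → B₁) (r₂ : A → B₂) where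

  sum-by-parts : (g : B₁ → B₂ → ℕ)
    → (∀ b₁ b₂ → ¬ g b₁ b₂ ≡ 0 → r₁ (glue b₁ b₂) ≡ b₁ × r₂ (glue b₁ b₂) ≡ b₂)
    → sumOver LA (λ S → indicator (S ≟ᴬ glue (r₁ S) (r₂ S)) * g (r₁ S) (r₂ S))
      ≡ sumOver L₁ (λ b₁ → sumOver L₂ (g b₁))
  sum-by-parts g retract = ≡-sym (
    begin
      sumOver L₁ (λ b₁ → sumOver L₂ (g b₁))
    ≡⟨ sumOver-cong L₁ (λ b₁ → sumOver-cong L₂ (λ b₂ → ≡-sym (trans (cong (g b₁ b₂ *_) (enumA (glue b₁ b₂))) (*-identityʳ _)))) ⟩
      sumOver L₁ (λ b₁ → sumOver L₂ (λ b₂ → g b₁ b₂ * sumOver LA (λ S → indicator (S ≟ᴬ glue b₁ b₂))))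
    ≡⟨ sumOver-cong L₁ (λ b₁ → sumOver-cong L₂ (λ b₂ →
         trans (≡-sym (sumOver-*ˡ LA (g b₁ b₂) _)) (sumOver-cong LA (λ S → *-comm (g b₁ b₂) _)))) ⟩
      sumOver L₁ (λ b₁ → sumOver L₂ (λ b₂ → sumOver LA (λ S → indicator (S ≟ᴬ glue b₁ b₂) * g b₁ b₂)))
    ≡⟨ sumOver-cong L₁ (λ b₁ → sumOver-swap L₂ LA _) ⟩
      sumOver L₁ (λ b₁ → sumOver LA (λ S → sumOver L₂ (λ b₂ → indicator (S ≟ᴬ glue b₁ b₂) * g b₁ b₂)))
    ≡⟨ sumOver-swap L₁ LA _ ⟩
      sumOver LA (λ S → sumOver L₁ (λ b₁ → sumOver L₂ (λ b₂ → indicator (S ≟ᴬ glue b₁ b₂) * g b₁ b₂)))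
    ≡⟨ sumOver-cong LA sum-at ⟩
      sumOver LA (λ S → indicator (S ≟ᴬ glue (r₁ S) (r₂ S)) * g (r₁ S) (r₂ S))
    ∎)
    where
    open ≡-Reasoning
    vanishes : ∀ S b₁ b₂ → ¬ (S ≡ glue b₁ b₂ × r₁ (glue b₁ b₂) ≡ b₁ × r₂ (glue b₁ b₂) ≡ b₂)
      → indicator (S ≟ᴬ glue b₁ b₂) * g b₁ b₂ ≡ 0
    vanishes S b₁ b₂ ¬glued with S ≟ᴬ glue b₁ b₂
    ... | no _ = refl
    ... | yes e with g b₁ b₂ in eg
    ...   | zero  = refl
    ...   | suc _ = ⊥-elim (¬glued (e , retract b₁ b₂ (λ g≡0 → 0≢1+n (trans (≡-sym g≡0) eg))))
    term : ∀ S b₁ b₂ → indicator (S ≟ᴬ glue b₁ b₂) * g b₁ b₂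
         ≡ indicator (b₁ ≟₁ r₁ S) * (indicator (b₂ ≟₂ r₂ S) * (indicator (S ≟ᴬ glue (r₁ S) (r₂ S)) * g (r₁ S) (r₂ S)))
    term S b₁ b₂ with b₁ ≟₁ r₁ S | b₂ ≟₂ r₂ S
    ... | yes refl | yes refl = ≡-sym (trans (+-identityʳ _) (+-identityʳ _))
    ... | yes _    | no b₂≢ = vanishes S b₁ b₂ (λ (e , _ , e₂) → b₂≢ (trans (≡-sym e₂) (cong r₂ (≡-sym e))))
    ... | no b₁≢   | _      = vanishes S b₁ b₂ (λ (e , e₁ , _) → b₁≢ (trans (≡-sym e₁) (cong r₁ (≡-sym e))))
    sum-at : ∀ S → sumOver L₁ (λ b₁ → sumOver L₂ (λ b₂ → indicator (S ≟ᴬ glue b₁ b₂) * g b₁ b₂))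
                 ≡ indicator (S ≟ᴬ glue (r₁ S) (r₂ S)) * g (r₁ S) (r₂ S)
    sum-at S = let K = indicator (S ≟ᴬ glue (r₁ S) (r₂ S)) * g (r₁ S) (r₂ S) in
      begin
        sumOver L₁ (λ b₁ → sumOver L₂ (λ b₂ → indicator (S ≟ᴬ glue b₁ b₂) * g b₁ b₂))
      ≡⟨ sumOver-cong L₁ (λ b₁ → sumOver-cong L₂ (term S b₁)) ⟩
        sumOver L₁ (λ b₁ → sumOver L₂ (λ b₂ → indicator (b₁ ≟₁ r₁ S) * (indicator (b₂ ≟₂ r₂ S) * K)))
      ≡⟨ sumOver-cong L₁ (λ b₁ → trans (sumOver-*ˡ L₂ (indicator (b₁ ≟₁ r₁ S)) _)
           (cong (indicator (b₁ ≟₁ r₁ S) *_) (trans (sumOver-*ʳ L₂ K _)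
             (trans (cong (_* K) (enum₂ (r₂ S))) (+-identityʳ K))))) ⟩
        sumOver L₁ (λ b₁ → indicator (b₁ ≟₁ r₁ S) * K)
      ≡⟨ trans (sumOver-*ʳ L₁ K _) (trans (cong (_* K) (enum₁ (r₁ S))) (+-identityʳ K)) ⟩
        K
      ∎

∑-cong : ∀ {n} {f g : Fin n → ℕ} → (∀ i → f i ≡ g i) → ∑ f ≡ ∑ g
∑-cong {zero}  h = refl
∑-cong {suc n} h = cong₂ _+_ (h zero) (∑-cong (λ i → h (suc i)))

∑-+ : ∀ {n} (f g : Fin n → ℕ) → ∑ (λ i → f i + g i) ≡ ∑ f + ∑ g
∑-+ {zero}  f g = refl
∑-+ {suc n} f g rewrite ∑-+ (λ i → f (suc i)) (λ i → g (suc i)) =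
  interchange +-commutativeSemigroup (f zero) (g zero) _ _

∑-*ˡ : ∀ {n} (k : ℕ) (f : Fin n → ℕ) → ∑ (λ i → k * f i) ≡ k * ∑ f
∑-*ˡ {zero}  k f = ≡-sym (*-zeroʳ k)
∑-*ˡ {suc n} k f rewrite ∑-*ˡ k (λ i → f (suc i)) = ≡-sym (*-distribˡ-+ k (f zero) _)

∑-zero : ∀ {n} → ∑ {n} (λ _ → 0) ≡ 0
∑-zero {zero}  = refl
∑-zero {suc n} = ∑-zero {n}

∑-↑ : ∀ m n (f : Fin (m + n) → ℕ) → ∑ f ≡ ∑ (λ i → f (i ↑ˡ n)) + ∑ (λ j → f (m ↑ʳ j))
∑-↑ zero    n f = refl
∑-↑ (suc m) n f rewrite ∑-↑ m n (λ i → f (suc i)) = ≡-sym (+-assoc (f zero) _ _)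

∑-swap : ∀ {m n} (f : Fin m → Fin n → ℕ) → ∑ (λ i → ∑ (f i)) ≡ ∑ (λ j → ∑ (λ i → f i j))
∑-swap {zero}  {n} f = ≡-sym (∑-zero {n})
∑-swap {suc m}     f rewrite ∑-swap (λ i → f (suc i)) = ≡-sym (∑-+ (f zero) (λ j → ∑ (λ i → f (suc i) j)))

∑-product : ∀ {m n} (f : Fin m → ℕ) (g : Fin n → ℕ) → ∑ (λ i → ∑ (λ j → f i * g j)) ≡ ∑ f * ∑ g
∑-product f g = trans (∑-cong (λ i → ∑-*ˡ (f i) g)) (trans (∑-cong (λ i → *-comm (f i) _)) (trans (∑-*ˡ (∑ g) f) (*-comm (∑ g) (∑ f))))

matrix : ∀ {n} → (Fin n → Fin n → Bool) → Mat n
matrix f = tabulate (λ i → tabulate (f i))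

madj-matrix : ∀ {n} (f : Fin n → Fin n → Bool) i j → madj (matrix f) i j ≡ f i j
madj-matrix f i j rewrite lookup∘tabulate (λ i → tabulate (f i)) i = lookup∘tabulate (f i) j

Mat-ext : ∀ {n} {S T : Mat n} → (∀ i j → madj S i j ≡ madj T i j) → S ≡ T
Mat-ext {S = S} {T} h = trans (≡-sym (tabulate∘lookup S))
  (trans (tabulate-cong (λ i → trans (≡-sym (tabulate∘lookup (lookup S i)))
                               (trans (tabulate-cong (h i)) (tabulate∘lookup (lookup T i)))))
         (tabulate∘lookup T))

_≟ᴹ_ : ∀ {n} → DecidableEquality (Mat n)
_≟ᴹ_ {n} = ≡-dec (≡-dec _≟ᴮ_)

allMats-enumerates : ∀ n → Enumerates (_≟ᴹ_ {n}) (allMats n)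
allMats-enumerates n = allVecs-enumerates _ _ (allVecs-enumerates _≟ᴮ_ _ bools n) n
  where
  bools : Enumerates _≟ᴮ_ (true ∷ false ∷ [])
  bools true  = refl
  bools false = refl

∈-allMats : ∀ {n} (S : Mat n) → S ∈ allMats n
∈-allMats {n} S = Enumerates⇒∈ _≟ᴹ_ (allMats n) (allMats-enumerates n) S

SpanSub-loopless : ∀ {n} (H : Graph n) {S} → SpanSub H S → ∀ p → madj S p p ≡ false
SpanSub-loopless H {S} (_ , sub) p with madj S p p in e
... | false = refl
... | true with trans (≡-sym (sub p p e)) (irr H p)
...   | ()

TwoForest-swap : ∀ {n} (H : Graph n) {i j S} → TwoForest H i j S → TwoForest H j i S
TwoForest-swap H (ss , t) = ss , IsTwoTree-swap (proj₁ ss) t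

numTwoForests-sym : ∀ {n} (H : Graph n) {F : Fin n → Fin n → ℕ} → (∀ i j → IsNumTwoForests H i j (F i j))
  → ∀ i j → F i j ≡ F j i
numTwoForests-sym H count i j =
  Count-unique (count i j) (count j i) (λ S → TwoForest-swap H {S = S}) (λ S → TwoForest-swap H {S = S})

numTwoForests-diag : ∀ {n} (H : Graph n) {F : Fin n → Fin n → ℕ} → (∀ i j → IsNumTwoForests H i j (F i j))
  → ∀ i → F i i ≡ 0
numTwoForests-diag H count i = Count-none (count i i) (λ S (_ , _ , i↛i , _) → i↛i here)

∑-factorˡ : ∀ {n} {f g : Fin n → ℕ} k → (∀ i → f i ≡ k * g i) → ∑ f ≡ k * ∑ g
∑-factorˡ {g = g} k f≡ = trans (∑-cong f≡) (∑-*ˡ k g)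

∑∑-factorˡ : ∀ {m n} {f g : Fin m → Fin n → ℕ} k → (∀ i j → f i j ≡ k * g i j)
  → ∑ (λ i → ∑ (f i)) ≡ k * ∑ (λ i → ∑ (g i))
∑∑-factorˡ {g = g} k f≡ = trans (∑-cong (λ i → ∑-factorˡ k (f≡ i))) (∑-*ˡ k (λ i → ∑ (g i)))

∑∑-rank-two : ∀ {m n} {f : Fin m → Fin n → ℕ} (p r : Fin m → ℕ) (q s : Fin n → ℕ)
  → (∀ i j → f i j ≡ p i * q j + r i * s j) → ∑ (λ i → ∑ (f i)) ≡ ∑ p * ∑ q + ∑ r * ∑ s
∑∑-rank-two p r q s f≡ =
  trans (∑-cong (λ i → trans (∑-cong (f≡ i)) (∑-+ (λ j → p i * q j) (λ j → r i * s j))))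
    (trans (∑-+ (λ i → ∑ (λ j → p i * q j)) (λ i → ∑ (λ j → r i * s j)))
      (cong₂ _+_ (∑-product p q) (∑-product r s)))

ind-∨ : ∀ x y z → (x ≡ true → y ≡ true → ⊥) → ind ((x ∨ y) ∧ z) ≡ ind (x ∧ z) + ind (y ∧ z)
ind-∨ true  true  z     excl = ⊥-elim (excl refl refl)
ind-∨ true  false true  _    = refl
ind-∨ true  false false _    = refl
ind-∨ false y     z     _    = refl

∑-ind-liftAdj : ∀ {m} (H : Graph m) x → ∑ (λ p → ind (liftAdj (adj H) x (just p))) ≡ maybe (deg H) 0 x
∑-ind-liftAdj H (just p) = refl
∑-ind-liftAdj {m} H nothing = ∑-zero {m}

<ᵇ-trichotomy : ∀ x y → ¬ x ≡ y → ind (x <ᵇ y) + ind (y <ᵇ x) ≡ 1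
<ᵇ-trichotomy zero    zero    x≢y = ⊥-elim (x≢y refl)
<ᵇ-trichotomy zero    (suc y) _   = refl
<ᵇ-trichotomy (suc x) zero    _   = refl
<ᵇ-trichotomy (suc x) (suc y) x≢y = <ᵇ-trichotomy x y (λ e → x≢y (cong suc e))

+-<ᵇ-+ : ∀ k x y → (k + x <ᵇ k + y) ≡ (x <ᵇ y)
+-<ᵇ-+ zero    x y = refl
+-<ᵇ-+ (suc k) x y = +-<ᵇ-+ k x y

handshake : ∀ {n} (H : Graph n) → ∑ (deg H) ≡ 2 * numEdges H
handshake {n} H =
  begin
    ∑ (deg H)
  ≡⟨ ∑-cong (λ p → trans (∑-cong (ind-adj p)) (∑-+ (forward p) (backward p))) ⟩
    ∑ (λ p → ∑ (forward p) + ∑ (backward p))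
  ≡⟨ ∑-+ (λ p → ∑ (forward p)) (λ p → ∑ (backward p)) ⟩
    numEdges H + ∑ (λ p → ∑ (backward p))
  ≡⟨ cong (numEdges H +_) (trans (∑-swap backward)
       (∑-cong (λ q → ∑-cong (λ p → cong (λ x → ind (x ∧ (toℕ q <ᵇ toℕ p))) (Graph.sym H p q))))) ⟩
    numEdges H + numEdges H
  ≡⟨ cong (numEdges H +_) (≡-sym (+-identityʳ (numEdges H))) ⟩
    2 * numEdges H
  ∎
  where
  open ≡-Reasoning
  forward backward : Fin n → Fin n → ℕ
  forward  p q = ind (adj H p q ∧ (toℕ p <ᵇ toℕ q))
  backward p q = ind (adj H p q ∧ (toℕ q <ᵇ toℕ p))
  ind-adj : ∀ p q → ind (adj H p q) ≡ forward p q + backward p q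
  ind-adj p q with adj H p q in e
  ... | false = refl
  ... | true  = ≡-sym (<ᵇ-trichotomy (toℕ p) (toℕ q) (λ eq → adj-irrefl H p q e (toℕ-injective eq)))

orderedEdge : ∀ {m} (H : Graph m) → Maybe (Fin m) → Maybe (Fin m) → ℕ
orderedEdge H (just p) (just q) = ind (adj H p q ∧ (toℕ p <ᵇ toℕ q))
orderedEdge H _        _        = 0

orderedEdge-nothingʳ : ∀ {m} (H : Graph m) x → orderedEdge H x nothing ≡ 0
orderedEdge-nothingʳ H (just _) = refl
orderedEdge-nothingʳ H nothing  = refl

module Wedge-of-Fin (a b : ℕ) where

  data View : Fin (a + suc b) → Set where
    is-left  : ∀ i → View (i ↑ˡ suc b)
    is-cut   : View (vG {a} {b})
    is-right : ∀ k → View (a ↑ʳ suc k)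

  view : ∀ u → View u
  view u with splitAt a u in eq
  ... | inj₁ i       = subst View (splitAt⁻¹-↑ˡ eq) (is-left i)
  ... | inj₂ zero    = subst View (splitAt⁻¹-↑ʳ eq) is-cut
  ... | inj₂ (suc k) = subst View (splitAt⁻¹-↑ʳ eq) (is-right k)

  data View₁ : Fin (a + 1) → Set where
    is-left₁ : ∀ i → View₁ (i ↑ˡ 1)
    is-cut₁  : View₁ (v₁ {a})

  view₁ : ∀ p → View₁ p
  view₁ p with splitAt a p in eq
  ... | inj₁ i    = subst View₁ (splitAt⁻¹-↑ˡ eq) (is-left₁ i)
  ... | inj₂ zero = subst View₁ (splitAt⁻¹-↑ʳ eq) is-cut₁

  classify-left : ∀ i → classify {a} {b} (i ↑ˡ suc b) ≡ left i
  classify-left i rewrite splitAt-↑ˡ a i (suc b) = refl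

  classify-cut : classify {a} {b} vG ≡ mid
  classify-cut rewrite splitAt-↑ʳ a (suc b) zero = refl

  classify-right : ∀ k → classify {a} {b} (a ↑ʳ suc k) ≡ right k
  classify-right k rewrite splitAt-↑ʳ a (suc b) (suc k) = refl

  left≢cut : ∀ i → ¬ (i ↑ˡ suc b) ≡ vG {a} {b}
  left≢cut i e with trans (≡-sym (classify-left i)) (trans (cong classify e) classify-cut)
  ... | ()

  right≢cut : ∀ k → ¬ (a ↑ʳ suc k) ≡ vG {a} {b}
  right≢cut k e with trans (≡-sym (classify-right k)) (trans (cong classify e) classify-cut)
  ... | ()

  pre₁-left : ∀ i → pre₁ {a} {b} (i ↑ˡ suc b) ≡ just (i ↑ˡ 1)
  pre₁-left i rewrite classify-left i = refl

  pre₁-cut : pre₁ {a} {b} vG ≡ just v₁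
  pre₁-cut rewrite classify-cut = refl

  pre₁-right : ∀ k → pre₁ {a} {b} (a ↑ʳ suc k) ≡ nothing
  pre₁-right k rewrite classify-right k = refl

  pre₂-left : ∀ i → pre₂ {a} {b} (i ↑ˡ suc b) ≡ nothing
  pre₂-left i rewrite classify-left i = refl

  pre₂-cut : pre₂ {a} {b} vG ≡ just zero
  pre₂-cut rewrite classify-cut = refl

  pre₂-right : ∀ k → pre₂ {a} {b} (a ↑ʳ suc k) ≡ just (suc k)
  pre₂-right k rewrite classify-right k = refl

  embed₁ : Fin (a + 1) → Fin (a + suc b)
  embed₁ p with splitAt a p
  ... | inj₁ i = i ↑ˡ suc b
  ... | inj₂ _ = vG

  embed₂ : Fin (suc b) → Fin (a + suc b)
  embed₂ zero    = vG
  embed₂ (suc k) = a ↑ʳ suc k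

  embed₁-left : ∀ i → embed₁ (i ↑ˡ 1) ≡ i ↑ˡ suc b
  embed₁-left i rewrite splitAt-↑ˡ a i 1 = refl

  embed₁-cut : embed₁ v₁ ≡ vG
  embed₁-cut rewrite splitAt-↑ʳ a 1 zero = refl

  pre₁-embed₁ : ∀ p → pre₁ (embed₁ p) ≡ just p
  pre₁-embed₁ p with view₁ p
  ... | is-left₁ i rewrite embed₁-left i = pre₁-left i
  ... | is-cut₁    rewrite embed₁-cut    = pre₁-cut

  pre₂-embed₂ : ∀ p → pre₂ {a} (embed₂ p) ≡ just p
  pre₂-embed₂ zero    = pre₂-cut
  pre₂-embed₂ (suc k) = pre₂-right k

  embed₁-pre₁ : ∀ u p → pre₁ u ≡ just p → embed₁ p ≡ u
  embed₁-pre₁ u p e with view u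
  embed₁-pre₁ _ p e | is-left i with trans (≡-sym e) (pre₁-left i)
  ... | refl = embed₁-left i
  embed₁-pre₁ _ p e | is-cut with trans (≡-sym e) pre₁-cut
  ... | refl = embed₁-cut
  embed₁-pre₁ _ p e | is-right k with trans (≡-sym e) (pre₁-right k)
  ... | ()

  embed₂-pre₂ : ∀ u p → pre₂ u ≡ just p → embed₂ p ≡ u
  embed₂-pre₂ u p e with view u
  embed₂-pre₂ _ p e | is-left i with trans (≡-sym e) (pre₂-left i)
  ... | ()
  embed₂-pre₂ _ p e | is-cut with trans (≡-sym e) pre₂-cut
  ... | refl = refl
  embed₂-pre₂ _ p e | is-right k with trans (≡-sym e) (pre₂-right k)
  ... | refl = refl

  pre-shared : ∀ u p q → pre₁ u ≡ just p → pre₂ u ≡ just q → u ≡ vG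
  pre-shared u p q e₁ e₂ with view u
  pre-shared _ p q e₁ e₂ | is-left i with trans (≡-sym e₂) (pre₂-left i)
  ... | ()
  pre-shared _ p q e₁ e₂ | is-cut = refl
  pre-shared _ p q e₁ e₂ | is-right k with trans (≡-sym e₁) (pre₁-right k)
  ... | ()

  pre-cover : ∀ u → (Σ (Fin (a + 1)) λ p → pre₁ u ≡ just p) ⊎ (Σ (Fin (suc b)) λ q → pre₂ u ≡ just q)
  pre-cover u with view u
  ... | is-left i  = inj₁ (_ , pre₁-left i)
  ... | is-cut     = inj₁ (_ , pre₁-cut)
  ... | is-right k = inj₂ (_ , pre₂-right k)

  wedge : Wedge (a + suc b) (a + 1) (suc b)
  wedge = record
    { π₁ = pre₁ ; π₂ = pre₂ ; ι₁ = embed₁ ; ι₂ = embed₂ ; c = vG ; c₁ = v₁ ; c₂ = zero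
    ; π₁-ι₁ = pre₁-embed₁ ; π₂-ι₂ = pre₂-embed₂ ; ι₁-π₁ = embed₁-pre₁ ; ι₂-π₂ = embed₂-pre₂
    ; π₁-c = pre₁-cut ; π₂-c = pre₂-cut ; π-shared = pre-shared ; π-cover = pre-cover
    }

  glueMat : Mat (a + 1) → Mat (suc b) → Mat (a + suc b)
  glueMat S₁ S₂ = matrix (λ u w → liftAdj (madj S₁) (pre₁ u) (pre₁ w) ∨ liftAdj (madj S₂) (pre₂ u) (pre₂ w))

  restrict₁ : Mat (a + suc b) → Mat (a + 1)
  restrict₁ S = matrix (λ p q → madj S (embed₁ p) (embed₁ q))

  restrict₂ : Mat (a + suc b) → Mat (suc b)
  restrict₂ S = matrix (λ p q → madj S (embed₂ p) (embed₂ q))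

  IsGlueOfRestrictions : Mat (a + suc b) → Set
  IsGlueOfRestrictions S = S ≡ glueMat (restrict₁ S) (restrict₂ S)

  madj-glueMat : ∀ {S} → IsGlueOfRestrictions S → ∀ u w
    → madj S u w ≡ liftAdj (madj (restrict₁ S)) (pre₁ u) (pre₁ w) ∨ liftAdj (madj (restrict₂ S)) (pre₂ u) (pre₂ w)
  madj-glueMat {S} glued u w = trans (cong (λ T → madj T u w) glued) (madj-matrix _ u w)

  madj-restrict₁ : ∀ S {u w p q} → pre₁ u ≡ just p → pre₁ w ≡ just q
    → liftAdj (madj (restrict₁ S)) (pre₁ u) (pre₁ w) ≡ madj S u w
  madj-restrict₁ S {u} {w} {p} {q} eu ew
    rewrite eu | ew | madj-matrix (λ p q → madj S (embed₁ p) (embed₁ q)) p q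
          | embed₁-pre₁ u p eu | embed₁-pre₁ w q ew = refl

  madj-restrict₂ : ∀ S {u w p q} → pre₂ u ≡ just p → pre₂ w ≡ just q
    → liftAdj (madj (restrict₂ S)) (pre₂ u) (pre₂ w) ≡ madj S u w
  madj-restrict₂ S {u} {w} {p} {q} eu ew
    rewrite eu | ew | madj-matrix (λ p q → madj S (embed₂ p) (embed₂ q)) p q
          | embed₂-pre₂ u p eu | embed₂-pre₂ w q ew = refl

  -- For a loopless part, gluing adds nothing on the other side's copy of the cut vertex.
  restrict-glueMat : ∀ S₁ S₂ → madj S₁ v₁ v₁ ≡ false → madj S₂ zero zero ≡ false
    → restrict₁ (glueMat S₁ S₂) ≡ S₁ × restrict₂ (glueMat S₁ S₂) ≡ S₂
  restrict-glueMat S₁ S₂ loopless₁ loopless₂ =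
      Mat-ext (λ p q → trans (madj-matrix (λ p q → madj (glueMat S₁ S₂) (embed₁ p) (embed₁ q)) p q)
        (trans (madj-matrix glued (embed₁ p) (embed₁ q))
        (trans (cong₂ _∨_ (liftAdj-just (madj S₁) (pre₁-embed₁ p) (pre₁-embed₁ q)) (other₂ p q)) (∨-identityʳ _))))
    , Mat-ext (λ p q → trans (madj-matrix (λ p q → madj (glueMat S₁ S₂) (embed₂ p) (embed₂ q)) p q)
        (trans (madj-matrix glued (embed₂ p) (embed₂ q))
        (cong₂ _∨_ (other₁ p q) (liftAdj-just (madj S₂) (pre₂-embed₂ p) (pre₂-embed₂ q)))))
    where
    glued : Fin (a + suc b) → Fin (a + suc b) → Bool
    glued u w = liftAdj (madj S₁) (pre₁ u) (pre₁ w) ∨ liftAdj (madj S₂) (pre₂ u) (pre₂ w)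
    other₂ : ∀ p q → liftAdj (madj S₂) (pre₂ (embed₁ p)) (pre₂ (embed₁ q)) ≡ false
    other₂ p q with view₁ p | view₁ q
    ... | is-left₁ i | _          = liftAdj-nothingˡ (madj S₂) (pre₂ (embed₁ q)) (trans (cong pre₂ (embed₁-left i)) (pre₂-left i))
    ... | is-cut₁    | is-left₁ j = liftAdj-nothingʳ (madj S₂) (pre₂ (embed₁ p)) (trans (cong pre₂ (embed₁-left j)) (pre₂-left j))
    ... | is-cut₁    | is-cut₁    = trans (liftAdj-just (madj S₂) (trans (cong pre₂ embed₁-cut) pre₂-cut)
                                                                  (trans (cong pre₂ embed₁-cut) pre₂-cut)) loopless₂
    other₁ : ∀ p q → liftAdj (madj S₁) (pre₁ (embed₂ p)) (pre₁ (embed₂ q)) ≡ false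
    other₁ (suc k) q       = liftAdj-nothingˡ (madj S₁) (pre₁ (embed₂ q)) (pre₁-right k)
    other₁ zero    (suc k) = liftAdj-nothingʳ (madj S₁) (pre₁ vG) (pre₁-right k)
    other₁ zero    zero    = trans (liftAdj-just (madj S₁) pre₁-cut pre₁-cut) loopless₁

  ∑-wedge : ∀ (g : Fin (a + suc b) → ℕ) → ∑ g ≡ ∑ (λ i → g (i ↑ˡ suc b)) + (g vG + ∑ (λ k → g (a ↑ʳ suc k)))
  ∑-wedge = ∑-↑ a (suc b)

  ∑-pre₁ : (h : Maybe (Fin (a + 1)) → ℕ) → h nothing ≡ 0 → ∑ (λ u → h (pre₁ u)) ≡ ∑ (λ p → h (just p))
  ∑-pre₁ h h-nothing =
    trans (∑-wedge (λ u → h (pre₁ u)))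
      (trans (cong₂ _+_ (∑-cong (λ i → cong h (pre₁-left i)))
               (cong₂ _+_ (cong h pre₁-cut) (trans (∑-cong (λ k → trans (cong h (pre₁-right k)) h-nothing)) (∑-zero {b}))))
        (≡-sym (∑-↑ a 1 (λ p → h (just p)))))

  ∑-pre₂ : (h : Maybe (Fin (suc b)) → ℕ) → h nothing ≡ 0 → ∑ (λ u → h (pre₂ {a} u)) ≡ ∑ (λ q → h (just q))
  ∑-pre₂ h h-nothing =
    trans (∑-wedge (λ u → h (pre₂ {a} u)))
      (cong₂ _+_ (trans (∑-cong (λ i → trans (cong h (pre₂-left i)) h-nothing)) (∑-zero {a}))
                 (cong₂ _+_ (cong h pre₂-cut) (∑-cong (λ k → cong h (pre₂-right k)))))

  toℕ-embed₁ : ∀ p → toℕ (embed₁ p) ≡ toℕ p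
  toℕ-embed₁ p with view₁ p
  ... | is-left₁ i = trans (cong toℕ (embed₁-left i)) (trans (toℕ-↑ˡ i (suc b)) (≡-sym (toℕ-↑ˡ i 1)))
  ... | is-cut₁    = trans (cong toℕ embed₁-cut) (trans (toℕ-↑ʳ a (zero {n = b})) (≡-sym (toℕ-↑ʳ a (zero {n = 0}))))

  toℕ-embed₂ : ∀ q → toℕ (embed₂ q) ≡ a + toℕ q
  toℕ-embed₂ zero    = toℕ-↑ʳ a (zero {n = b})
  toℕ-embed₂ (suc k) = toℕ-↑ʳ a (suc k)

  ∑∑-wedge : ∀ (T : Fin (a + suc b) → Fin (a + suc b) → ℕ) → ∑ (λ u → ∑ (T u))
    ≡ (∑ (λ i → ∑ (λ j → T (i ↑ˡ suc b) (j ↑ˡ suc b))) + (∑ (λ i → T (i ↑ˡ suc b) vG)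
        + ∑ (λ i → ∑ (λ l → T (i ↑ˡ suc b) (a ↑ʳ suc l)))))
    + ((∑ (λ j → T vG (j ↑ˡ suc b)) + (T vG vG + ∑ (λ l → T vG (a ↑ʳ suc l))))
      + (∑ (λ k → ∑ (λ j → T (a ↑ʳ suc k) (j ↑ˡ suc b))) + (∑ (λ k → T (a ↑ʳ suc k) vG)
          + ∑ (λ k → ∑ (λ l → T (a ↑ʳ suc k) (a ↑ʳ suc l))))))
  ∑∑-wedge T =
    trans (∑-cong (λ u → ∑-wedge (T u)))
      (trans (∑-wedge (λ u → ∑ (λ j → T u (j ↑ˡ suc b)) + (T u vG + ∑ (λ l → T u (a ↑ʳ suc l)))))
        (cong₂ _+_ (split3 (λ i → i ↑ˡ suc b)) (cong₂ _+_ refl (split3 (λ k → a ↑ʳ suc k)))))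
    where
    split3 : ∀ {m} (row : Fin m → Fin (a + suc b))
      → ∑ (λ r → ∑ (λ j → T (row r) (j ↑ˡ suc b)) + (T (row r) vG + ∑ (λ l → T (row r) (a ↑ʳ suc l))))
      ≡ ∑ (λ r → ∑ (λ j → T (row r) (j ↑ˡ suc b))) + (∑ (λ r → T (row r) vG) + ∑ (λ r → ∑ (λ l → T (row r) (a ↑ʳ suc l))))
    split3 row = trans (∑-+ (λ r → ∑ (λ j → T (row r) (j ↑ˡ suc b))) (λ r → T (row r) vG + ∑ (λ l → T (row r) (a ↑ʳ suc l))))
                       (cong₂ _+_ refl (∑-+ (λ r → T (row r) vG) (λ r → ∑ (λ l → T (row r) (a ↑ʳ suc l)))))

  restrict₁-lift : ∀ S u w → liftAdj (madj (restrict₁ S)) (pre₁ u) (pre₁ w) ≡ false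
                           ⊎ liftAdj (madj (restrict₁ S)) (pre₁ u) (pre₁ w) ≡ madj S u w
  restrict₁-lift S u w with pre₁ u in eu | pre₁ w in ew
  ... | just p  | just q  =
    inj₂ (trans (cong₂ (liftAdj (madj (restrict₁ S))) (≡-sym eu) (≡-sym ew)) (madj-restrict₁ S eu ew))
  ... | just _  | nothing = inj₁ refl
  ... | nothing | _       = inj₁ refl

  restrict₂-lift : ∀ S u w → liftAdj (madj (restrict₂ S)) (pre₂ u) (pre₂ w) ≡ false
                           ⊎ liftAdj (madj (restrict₂ S)) (pre₂ u) (pre₂ w) ≡ madj S u w
  restrict₂-lift S u w with pre₂ u in eu | pre₂ w in ew
  ... | just p  | just q  =
    inj₂ (trans (cong₂ (liftAdj (madj (restrict₂ S))) (≡-sym eu) (≡-sym ew)) (madj-restrict₂ S eu ew))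
  ... | just _  | nothing = inj₁ refl
  ... | nothing | _       = inj₁ refl

  module Glued-graphs (H₁ : Graph (a + 1)) (H₂ : Graph (suc b)) (G : Graph (a + suc b)) (G-glue : IsGlue H₁ H₂ G) where

    graphs : Glued wedge
    graphs = record
      { E₁ = adj H₁ ; E₂ = adj H₂ ; E = adj G ; E-glued = G-glue
      ; E₁-irrefl = adj-irrefl H₁ ; E₂-irrefl = adj-irrefl H₂ ; E₁-sym = Graph.sym H₁ ; E₂-sym = Graph.sym H₂ }

    private
      module G₁ = Side graphs
      module G₂ = Side (Glued-flip graphs)

    SpanSub-split : ∀ S → SpanSub G S
      → IsGlueOfRestrictions S × SpanSub H₁ (restrict₁ S) × SpanSub H₂ (restrict₂ S)
    SpanSub-split S (S-sym , S⊆G) = Mat-ext (λ u w → trans (glued u w) (≡-sym (madj-matrix _ u w)))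
                                  , (sym₁ , sub₁) , (sym₂ , sub₂)
      where
      false≢true : ∀ {x : Bool} → x ≡ false → ¬ x ≡ true
      false≢true refl ()
      glued : ∀ u w → madj S u w
        ≡ liftAdj (madj (restrict₁ S)) (pre₁ u) (pre₁ w) ∨ liftAdj (madj (restrict₂ S)) (pre₂ u) (pre₂ w)
      glued u w with restrict₁-lift S u w | restrict₂-lift S u w
      ... | inj₂ l₁ | inj₂ l₂ rewrite l₁ | l₂ = ≡-sym (∨-idem _)
      ... | inj₂ l₁ | inj₁ f₂ rewrite l₁ | f₂ = ≡-sym (∨-identityʳ _)
      ... | inj₁ f₁ | inj₂ l₂ rewrite f₁ | l₂ = refl
      ... | inj₁ f₁ | inj₁ f₂ rewrite f₁ | f₂ with madj S u w in e
      ...   | false = refl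
      ...   | true with G₁.E-split u w (S⊆G u w e)
      ...     | inj₁ (_ , _ , eu , ew , _) = ⊥-elim (false≢true f₁ (trans (madj-restrict₁ S eu ew) e))
      ...     | inj₂ (_ , _ , eu , ew , _) = ⊥-elim (false≢true f₂ (trans (madj-restrict₂ S eu ew) e))
      sym₁ : ∀ p q → madj (restrict₁ S) p q ≡ madj (restrict₁ S) q p
      sym₁ p q rewrite madj-matrix (λ p q → madj S (embed₁ p) (embed₁ q)) p q
                     | madj-matrix (λ p q → madj S (embed₁ p) (embed₁ q)) q p = S-sym _ _
      sym₂ : ∀ p q → madj (restrict₂ S) p q ≡ madj (restrict₂ S) q p
      sym₂ p q rewrite madj-matrix (λ p q → madj S (embed₂ p) (embed₂ q)) p q
                     | madj-matrix (λ p q → madj S (embed₂ p) (embed₂ q)) q p = S-sym _ _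
      sub₁ : ∀ p q → madj (restrict₁ S) p q ≡ true → adj H₁ p q ≡ true
      sub₁ p q e rewrite madj-matrix (λ p q → madj S (embed₁ p) (embed₁ q)) p q =
        subst₂ (λ x y → adj H₁ x y ≡ true) (G₁.side₁-ι₁ p) (G₁.side₁-ι₁ q)
          (G₁.E⇒E₁ (G₁.On₁-ι₁ p) (G₁.On₁-ι₁ q) (S⊆G _ _ e))
      sub₂ : ∀ p q → madj (restrict₂ S) p q ≡ true → adj H₂ p q ≡ true
      sub₂ p q e rewrite madj-matrix (λ p q → madj S (embed₂ p) (embed₂ q)) p q =
        subst₂ (λ x y → adj H₂ x y ≡ true) (G₂.side₁-ι₁ p) (G₂.side₁-ι₁ q)
          (G₂.E⇒E₁ (G₂.On₁-ι₁ p) (G₂.On₁-ι₁ q) (S⊆G _ _ e))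

    SpanSub-glue : ∀ S → IsGlueOfRestrictions S → SpanSub H₁ (restrict₁ S) → SpanSub H₂ (restrict₂ S) → SpanSub G S
    SpanSub-glue S glued (sym₁ , sub₁) (sym₂ , sub₂) = S-sym , S⊆G
      where
      S-sym : ∀ u w → madj S u w ≡ madj S w u
      S-sym u w rewrite madj-glueMat glued u w | madj-glueMat glued w u
                      | liftAdj-sym (madj (restrict₁ S)) sym₁ (pre₁ u) (pre₁ w)
                      | liftAdj-sym (madj (restrict₂ S)) sym₂ (pre₂ u) (pre₂ w) = refl
      S⊆G : ∀ u w → madj S u w ≡ true → adj G u w ≡ true
      S⊆G u w e with ∨-true {liftAdj (madj (restrict₁ S)) (pre₁ u) (pre₁ w)} (trans (≡-sym (madj-glueMat glued u w)) e)
      ... | inj₁ l with liftAdj-true (madj (restrict₁ S)) (pre₁ u) (pre₁ w) l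
      ...   | p , q , eu , ew , m =
        trans (G-glue u w) (cong (_∨ liftAdj (adj H₂) (pre₂ u) (pre₂ w)) (trans (liftAdj-just (adj H₁) eu ew) (sub₁ p q m)))
      S⊆G u w e | inj₂ l with liftAdj-true (madj (restrict₂ S)) (pre₂ u) (pre₂ w) l
      ...   | p , q , eu , ew , m =
        trans (G-glue u w) (trans (cong (liftAdj (adj H₁) (pre₁ u) (pre₁ w) ∨_)
          (trans (liftAdj-just (adj H₂) eu ew) (sub₂ p q m))) (∨-zeroʳ _))

    parts : ∀ S → IsGlueOfRestrictions S → SpanSub H₁ (restrict₁ S) → SpanSub H₂ (restrict₂ S) → Glued wedge
    parts S glued (sym₁ , sub₁) (sym₂ , sub₂) = record
      { E₁ = madj (restrict₁ S) ; E₂ = madj (restrict₂ S) ; E = madj S ; E-glued = madj-glueMat glued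
      ; E₁-irrefl = λ p q e → adj-irrefl H₁ p q (sub₁ p q e)
      ; E₂-irrefl = λ p q e → adj-irrefl H₂ p q (sub₂ p q e)
      ; E₁-sym = sym₁ ; E₂-sym = sym₂ }

    module Parts S glued ss₁ ss₂ = Gluing (parts S glued ss₁ ss₂)

    SpanningTree-split : ∀ S → SpanningTree G S
      → IsGlueOfRestrictions S × SpanningTree H₁ (restrict₁ S) × SpanningTree H₂ (restrict₂ S)
    SpanningTree-split S (ss , tree) with SpanSub-split S ss
    ... | glued , ss₁ , ss₂ with Parts.IsTree-split S glued ss₁ ss₂ tree
    ...   | tree₁ , tree₂ = glued , (ss₁ , tree₁) , (ss₂ , tree₂)

    SpanningTree-glue : ∀ S → IsGlueOfRestrictions S
      → SpanningTree H₁ (restrict₁ S) → SpanningTree H₂ (restrict₂ S) → SpanningTree G S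
    SpanningTree-glue S glued (ss₁ , tree₁) (ss₂ , tree₂) =
      SpanSub-glue S glued ss₁ ss₂ , Parts.IsTree-glue S glued ss₁ ss₂ tree₁ tree₂

    TwoForest-within₁-split : ∀ S {u w p q} → pre₁ u ≡ just p → pre₁ w ≡ just q → TwoForest G u w S
      → IsGlueOfRestrictions S × TwoForest H₁ p q (restrict₁ S) × SpanningTree H₂ (restrict₂ S)
    TwoForest-within₁-split S eu ew (ss , t) with SpanSub-split S ss
    ... | glued , ss₁ , ss₂ with Parts.IsTwoTree-within₁-split S glued ss₁ ss₂ (_ , eu) (_ , ew) t
    ...   | t₁ , tree₂ =
      glued , (ss₁ , subst₂ (IsTwoTree (madj (restrict₁ S))) (cong (fromMaybe v₁) eu) (cong (fromMaybe v₁) ew) t₁)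
            , (ss₂ , tree₂)

    TwoForest-within₁-glue : ∀ S {u w p q} → pre₁ u ≡ just p → pre₁ w ≡ just q → IsGlueOfRestrictions S
      → TwoForest H₁ p q (restrict₁ S) → SpanningTree H₂ (restrict₂ S) → TwoForest G u w S
    TwoForest-within₁-glue S eu ew glued (ss₁ , t₁) (ss₂ , tree₂) =
        SpanSub-glue S glued ss₁ ss₂
      , Parts.IsTwoTree-within₁-glue S glued ss₁ ss₂ (_ , eu) (_ , ew)
          (subst₂ (IsTwoTree (madj (restrict₁ S))) (cong (fromMaybe v₁) (≡-sym eu)) (cong (fromMaybe v₁) (≡-sym ew)) t₁)
          tree₂

    TwoForest-within₂-split : ∀ S {u w p q} → pre₂ u ≡ just p → pre₂ w ≡ just q → TwoForest G u w S
      → IsGlueOfRestrictions S × SpanningTree H₁ (restrict₁ S) × TwoForest H₂ p q (restrict₂ S)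
    TwoForest-within₂-split S eu ew (ss , t) with SpanSub-split S ss
    ... | glued , ss₁ , ss₂ with Parts.IsTwoTree-within₂-split S glued ss₁ ss₂ (_ , eu) (_ , ew) t
    ...   | t₂ , tree₁ =
      glued , (ss₁ , tree₁)
            , (ss₂ , subst₂ (IsTwoTree (madj (restrict₂ S))) (cong (fromMaybe zero) eu) (cong (fromMaybe zero) ew) t₂)

    TwoForest-within₂-glue : ∀ S {u w p q} → pre₂ u ≡ just p → pre₂ w ≡ just q → IsGlueOfRestrictions S
      → SpanningTree H₁ (restrict₁ S) → TwoForest H₂ p q (restrict₂ S) → TwoForest G u w S
    TwoForest-within₂-glue S eu ew glued (ss₁ , tree₁) (ss₂ , t₂) =
        SpanSub-glue S glued ss₁ ss₂
      , Parts.IsTwoTree-within₂-glue S glued ss₁ ss₂ (_ , eu) (_ , ew)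
          (subst₂ (IsTwoTree (madj (restrict₂ S))) (cong (fromMaybe zero) (≡-sym eu)) (cong (fromMaybe zero) (≡-sym ew)) t₂)
          tree₁

    SplitAcross : Fin (a + 1) → Fin (suc b) → Mat (a + 1) → Mat (suc b) → Set
    SplitAcross p q S₁ S₂ = (TwoForest H₁ p v₁ S₁ × SpanningTree H₂ S₂) ⊎ (SpanningTree H₁ S₁ × TwoForest H₂ zero q S₂)

    TwoForest-across-split : ∀ S {u w p q} → pre₁ u ≡ just p → ¬ u ≡ vG → pre₂ w ≡ just q → ¬ w ≡ vG
      → TwoForest G u w S → IsGlueOfRestrictions S × SplitAcross p q (restrict₁ S) (restrict₂ S)
    TwoForest-across-split S eu u≢c ew w≢c (ss , t) with SpanSub-split S ss
    ... | glued , ss₁ , ss₂ with Parts.IsTwoTree-across-split S glued ss₁ ss₂ ((_ , eu) , u≢c) ((_ , ew) , w≢c) t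
    ...   | inj₁ (t₁ , tree₂) =
      glued , inj₁ ((ss₁ , subst (λ x → IsTwoTree _ x v₁) (cong (fromMaybe v₁) eu) t₁) , (ss₂ , tree₂))
    ...   | inj₂ (tree₁ , t₂) =
      glued , inj₂ ((ss₁ , tree₁) , (ss₂ , subst (IsTwoTree _ zero) (cong (fromMaybe zero) ew) t₂))

    TwoForest-across-glue : ∀ S {u w p q} → pre₁ u ≡ just p → pre₂ w ≡ just q → IsGlueOfRestrictions S
      → SplitAcross p q (restrict₁ S) (restrict₂ S) → TwoForest G u w S
    TwoForest-across-glue S eu ew glued (inj₁ ((ss₁ , t₁) , (ss₂ , tree₂))) =
        SpanSub-glue S glued ss₁ ss₂
      , Parts.IsTwoTree-across-glue S glued ss₁ ss₂ (_ , eu) (_ , ew)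
          (inj₁ (subst (λ x → IsTwoTree _ x v₁) (cong (fromMaybe v₁) (≡-sym eu)) t₁ , tree₂))
    TwoForest-across-glue S eu ew glued (inj₂ ((ss₁ , tree₁) , (ss₂ , t₂))) =
        SpanSub-glue S glued ss₁ ss₂
      , Parts.IsTwoTree-across-glue S glued ss₁ ss₂ (_ , eu) (_ , ew)
          (inj₂ (tree₁ , subst (IsTwoTree _ zero) (cong (fromMaybe zero) (≡-sym ew)) t₂))

    edge₁ edge₂ : Fin (a + suc b) → Fin (a + suc b) → Bool
    edge₁ u w = liftAdj (adj H₁) (pre₁ u) (pre₁ w)
    edge₂ u w = liftAdj (adj H₂) (pre₂ {a} u) (pre₂ {a} w)

    edge-on-one-side : ∀ u w → edge₁ u w ≡ true → edge₂ u w ≡ true → ⊥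
    edge-on-one-side u w e₁ e₂ with liftAdj-true (adj H₁) _ _ e₁ | liftAdj-true (adj H₂) _ _ e₂
    ... | p , q , eu , ew , adj₁ | p′ , q′ , eu′ , ew′ , _ =
      adj-irrefl H₁ p q adj₁ (just-injective (trans (≡-sym eu) (trans (cong pre₁ u≡w) ew)))
      where
      u≡w : u ≡ w
      u≡w = trans (pre-shared u p p′ eu eu′) (≡-sym (pre-shared w q q′ ew ew′))

    ind-adj-glue : ∀ u w z → ind (adj G u w ∧ z) ≡ ind (edge₁ u w ∧ z) + ind (edge₂ u w ∧ z)
    ind-adj-glue u w z = trans (cong (λ x → ind (x ∧ z)) (G-glue u w)) (ind-∨ _ _ z (edge-on-one-side u w))

    deg-glue : ∀ u → deg G u ≡ padL H₁ u + padR {a = a} H₂ u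
    deg-glue u =
      begin
        deg G u
      ≡⟨ ∑-cong (λ w → trans (cong ind (≡-sym (∧-identityʳ (adj G u w))))
           (trans (ind-adj-glue u w true) (cong₂ _+_ (cong ind (∧-identityʳ (edge₁ u w))) (cong ind (∧-identityʳ (edge₂ u w)))))) ⟩
        ∑ (λ w → ind (edge₁ u w) + ind (edge₂ u w))
      ≡⟨ ∑-+ (λ w → ind (edge₁ u w)) (λ w → ind (edge₂ u w)) ⟩
        ∑ (λ w → ind (edge₁ u w)) + ∑ (λ w → ind (edge₂ u w))
      ≡⟨ cong₂ _+_
           (trans (∑-pre₁ (λ y → ind (liftAdj (adj H₁) (pre₁ u) y)) (cong ind (liftAdj-nothingʳ (adj H₁) (pre₁ u) refl)))
                  (∑-ind-liftAdj H₁ (pre₁ u)))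
           (trans (∑-pre₂ (λ y → ind (liftAdj (adj H₂) (pre₂ u) y)) (cong ind (liftAdj-nothingʳ (adj H₂) (pre₂ u) refl)))
                  (∑-ind-liftAdj H₂ (pre₂ u))) ⟩
        padL H₁ u + padR H₂ u
      ∎
      where open ≡-Reasoning

    ordered₁ ordered₂ : Fin (a + suc b) → Fin (a + suc b) → ℕ
    ordered₁ u w = orderedEdge H₁ (pre₁ u) (pre₁ w)
    ordered₂ u w = orderedEdge H₂ (pre₂ {a} u) (pre₂ {a} w)

    edge₁-ordered : ∀ u w → ind (edge₁ u w ∧ (toℕ u <ᵇ toℕ w)) ≡ ordered₁ u w
    edge₁-ordered u w with pre₁ u in eu | pre₁ w in ew
    ... | just p  | just q  = cong (λ z → ind (adj H₁ p q ∧ z)) (cong₂ _<ᵇ_ (toℕ-side eu) (toℕ-side ew))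
      where
      toℕ-side : ∀ {x p} → pre₁ x ≡ just p → toℕ x ≡ toℕ p
      toℕ-side {x} {p} e = trans (cong toℕ (≡-sym (embed₁-pre₁ x p e))) (toℕ-embed₁ p)
    ... | just _  | nothing = refl
    ... | nothing | _       = refl

    edge₂-ordered : ∀ u w → ind (edge₂ u w ∧ (toℕ u <ᵇ toℕ w)) ≡ ordered₂ u w
    edge₂-ordered u w with pre₂ u in eu | pre₂ w in ew
    ... | just p  | just q  =
      cong (λ z → ind (adj H₂ p q ∧ z)) (trans (cong₂ _<ᵇ_ (toℕ-side eu) (toℕ-side ew)) (+-<ᵇ-+ a (toℕ p) (toℕ q)))
      where
      toℕ-side : ∀ {x p} → pre₂ x ≡ just p → toℕ x ≡ a + toℕ p
      toℕ-side {x} {p} e = trans (cong toℕ (≡-sym (embed₂-pre₂ x p e))) (toℕ-embed₂ p)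
    ... | just _  | nothing = refl
    ... | nothing | _       = refl

    numEdges-glue : numEdges G ≡ numEdges H₁ + numEdges H₂
    numEdges-glue =
      begin
        numEdges G
      ≡⟨ ∑-cong (λ u → trans (∑-cong (λ w → trans (ind-adj-glue u w _) (cong₂ _+_ (edge₁-ordered u w) (edge₂-ordered u w))))
                              (∑-+ (ordered₁ u) (ordered₂ u))) ⟩
        ∑ (λ u → ∑ (ordered₁ u) + ∑ (ordered₂ u))
      ≡⟨ ∑-+ (λ u → ∑ (ordered₁ u)) (λ u → ∑ (ordered₂ u)) ⟩
        ∑ (λ u → ∑ (ordered₁ u)) + ∑ (λ u → ∑ (ordered₂ u))
      ≡⟨ cong₂ _+_
           (trans (∑-cong (λ u → ∑-pre₁ (orderedEdge H₁ (pre₁ u)) (orderedEdge-nothingʳ H₁ (pre₁ u))))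
                  (∑-pre₁ (λ x → ∑ (λ q → orderedEdge H₁ x (just q))) (∑-zero {a + 1})))
           (trans (∑-cong (λ u → ∑-pre₂ (orderedEdge H₂ (pre₂ {a} u)) (orderedEdge-nothingʳ H₂ (pre₂ {a} u))))
                  (∑-pre₂ (λ x → ∑ (λ q → orderedEdge H₂ x (just q))) (∑-zero {suc b}))) ⟩
        numEdges H₁ + numEdges H₂
      ∎
      where open ≡-Reasoning

Count-dec-allMats : ∀ {n} {P : Mat n → Set} {k} → Count P (allMats n) k → ∀ S → Dec (P S)
Count-dec-allMats count S = Count-dec count (∈-allMats S)

module Counting (a b : ℕ) (H₁ : Graph (a + 1)) (H₂ : Graph (suc b)) (G : Graph (a + suc b))
  (G-glue : IsGlue H₁ H₂ G) where

  open Wedge-of-Fin a b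
  open Glued-graphs H₁ H₂ G G-glue

  private
    module ByParts = CountByParts _≟ᴹ_ _≟ᴹ_ _≟ᴹ_ (allMats (a + suc b)) (allMats (a + 1)) (allMats (suc b))
      (allMats-enumerates _) (allMats-enumerates _) (allMats-enumerates _) glueMat restrict₁ restrict₂

  -- Each counted subgraph of G is the gluing of its restrictions, so counting subgraphs of G
  -- amounts to counting pairs of subgraphs of H₁ and H₂.
  count-by-parts : ∀ {P : Mat (a + suc b) → Set} {k} → Count P (allMats (a + suc b)) k
    → (Q : Mat (a + 1) → Mat (suc b) → Set) (Q? : ∀ S₁ S₂ → Dec (Q S₁ S₂))
    → (∀ S → P S → IsGlueOfRestrictions S × Q (restrict₁ S) (restrict₂ S))
    → (∀ S → IsGlueOfRestrictions S × Q (restrict₁ S) (restrict₂ S) → P S)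
    → (∀ {S₁ S₂} → Q S₁ S₂ → SpanSub H₁ S₁ × SpanSub H₂ S₂)
    → k ≡ sumOver (allMats (a + 1)) (λ S₁ → sumOver (allMats (suc b)) (λ S₂ → indicator (Q? S₁ S₂)))
  count-by-parts count Q Q? split glue spanning =
    trans (Count≡sumOver count P?)
      (trans (sumOver-cong (allMats (a + suc b)) (λ S →
                trans (indicator-cong (split S) (glue S) (P? S) ((S ≟ᴹ glued S) ×-dec Q? (restrict₁ S) (restrict₂ S)))
                      (indicator-× (S ≟ᴹ glued S) (Q? (restrict₁ S) (restrict₂ S)))))
             (ByParts.sum-by-parts (λ S₁ S₂ → indicator (Q? S₁ S₂)) retract))
    where
    P? = Count-dec-allMats count
    glued : Mat (a + suc b) → Mat (a + suc b)
    glued S = glueMat (restrict₁ S) (restrict₂ S)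
    retract : ∀ S₁ S₂ → ¬ indicator (Q? S₁ S₂) ≡ 0 → restrict₁ (glueMat S₁ S₂) ≡ S₁ × restrict₂ (glueMat S₁ S₂) ≡ S₂
    retract S₁ S₂ ≢0 with spanning (indicator≢0 (Q? S₁ S₂) ≢0)
    ... | ss₁ , ss₂ = restrict-glueMat S₁ S₂ (SpanSub-loopless H₁ {S₁} ss₁ v₁) (SpanSub-loopless H₂ {S₂} ss₂ zero)

  d₁ : Fin a → ℕ
  d₁ i = deg H₁ (i ↑ˡ 1)

  δ₁ : ℕ
  δ₁ = deg H₁ v₁

  d₂ : Fin b → ℕ
  d₂ k = deg H₂ (suc k)

  δ₂ : ℕ
  δ₂ = deg H₂ zero

  deg-left : ∀ i → deg G (i ↑ˡ suc b) ≡ d₁ i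
  deg-left i = trans (deg-glue _)
    (trans (cong₂ _+_ (cong (maybe (deg H₁) 0) (pre₁-left i)) (cong (maybe (deg H₂) 0) (pre₂-left i))) (+-identityʳ _))

  deg-cut : deg G vG ≡ δ₁ + δ₂
  deg-cut = trans (deg-glue _) (cong₂ _+_ (cong (maybe (deg H₁) 0) pre₁-cut) (cong (maybe (deg H₂) 0) pre₂-cut))

  deg-right : ∀ k → deg G (a ↑ʳ suc k) ≡ d₂ k
  deg-right k = trans (deg-glue _) (cong₂ _+_ (cong (maybe (deg H₁) 0) (pre₁-right k)) (cong (maybe (deg H₂) 0) (pre₂-right k)))

  edges₁ : 2 * numEdges H₁ ≡ ∑ d₁ + δ₁
  edges₁ = trans (≡-sym (handshake H₁)) (trans (∑-↑ a 1 (deg H₁)) (cong (∑ d₁ +_) (+-identityʳ δ₁)))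

  edges₂ : 2 * numEdges H₂ ≡ δ₂ + ∑ d₂
  edges₂ = ≡-sym (handshake H₂)

  module Counting-with {t₁ t₂ tG : ℕ} {F₁ : Fin (a + 1) → Fin (a + 1) → ℕ} {F₂ : Fin (suc b) → Fin (suc b) → ℕ}
    {FG : Fin (a + suc b) → Fin (a + suc b) → ℕ}
    (T₁ : IsNumSpanningTrees H₁ t₁) (T₂ : IsNumSpanningTrees H₂ t₂) (Tᴳ : IsNumSpanningTrees G tG)
    (TF₁ : ∀ i j → IsNumTwoForests H₁ i j (F₁ i j)) (TF₂ : ∀ i j → IsNumTwoForests H₂ i j (F₂ i j))
    (TFᴳ : ∀ u w → IsNumTwoForests G u w (FG u w)) where

    private
      tree₁? = Count-dec-allMats T₁
      tree₂? = Count-dec-allMats T₂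
      forest₁? = λ p q → Count-dec-allMats (TF₁ p q)
      forest₂? = λ p q → Count-dec-allMats (TF₂ p q)

    numSpanningTrees-glue : tG ≡ t₁ * t₂
    numSpanningTrees-glue =
      trans (count-by-parts Tᴳ _ (λ S₁ S₂ → tree₁? S₁ ×-dec tree₂? S₂)
               SpanningTree-split (λ S (glued , x , y) → SpanningTree-glue S glued x y) (λ (x , y) → proj₁ x , proj₁ y))
            (sumOver-indicator-× T₁ T₂ tree₁? tree₂?)

    numTwoForests-within₁ : ∀ {u w p q} → pre₁ u ≡ just p → pre₁ w ≡ just q → FG u w ≡ t₂ * F₁ p q
    numTwoForests-within₁ {u} {w} {p} {q} eu ew =
      trans (count-by-parts (TFᴳ u w) _ (λ S₁ S₂ → forest₁? p q S₁ ×-dec tree₂? S₂)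
               (λ S → TwoForest-within₁-split S eu ew) (λ S (glued , x , y) → TwoForest-within₁-glue S eu ew glued x y)
               (λ (x , y) → proj₁ x , proj₁ y))
            (trans (sumOver-indicator-× (TF₁ p q) T₂ (forest₁? p q) tree₂?) (*-comm (F₁ p q) t₂))

    numTwoForests-within₂ : ∀ {u w p q} → pre₂ u ≡ just p → pre₂ w ≡ just q → FG u w ≡ t₁ * F₂ p q
    numTwoForests-within₂ {u} {w} {p} {q} eu ew =
      trans (count-by-parts (TFᴳ u w) _ (λ S₁ S₂ → tree₁? S₁ ×-dec forest₂? p q S₂)
               (λ S → TwoForest-within₂-split S eu ew) (λ S (glued , x , y) → TwoForest-within₂-glue S eu ew glued x y)
               (λ (x , y) → proj₁ x , proj₁ y))
            (sumOver-indicator-× T₁ (TF₂ p q) tree₁? (forest₂? p q))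

    numTwoForests-across : ∀ {u w p q} → pre₁ u ≡ just p → ¬ u ≡ vG → pre₂ w ≡ just q → ¬ w ≡ vG
      → FG u w ≡ t₂ * F₁ p v₁ + t₁ * F₂ zero q
    numTwoForests-across {u} {w} {p} {q} eu u≢c ew w≢c =
      trans (count-by-parts (TFᴳ u w) (SplitAcross p q) across?
               (λ S → TwoForest-across-split S eu u≢c ew w≢c) (λ S (glued , x) → TwoForest-across-glue S eu ew glued x)
               (λ { (inj₁ (x , y)) → proj₁ x , proj₁ y ; (inj₂ (x , y)) → proj₁ x , proj₁ y }))
      (trans (sumOver-cong (allMats (a + 1)) (λ S₁ → trans
                (sumOver-cong (allMats (suc b)) (λ S₂ → indicator-⊎ (forest₁? p v₁ S₁ ×-dec tree₂? S₂)
                  (tree₁? S₁ ×-dec forest₂? zero q S₂) (λ (two , _) (tree , _) → separated {S₁} two tree)))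
                (sumOver-+ (allMats (suc b)) _ _)))
      (trans (sumOver-+ (allMats (a + 1)) _ _)
        (cong₂ _+_ (trans (sumOver-indicator-× (TF₁ p v₁) T₂ (forest₁? p v₁) tree₂?) (*-comm (F₁ p v₁) t₂))
                   (sumOver-indicator-× T₁ (TF₂ zero q) tree₁? (forest₂? zero q)))))
      where
      across? : ∀ S₁ S₂ → Dec (SplitAcross p q S₁ S₂)
      across? S₁ S₂ = (forest₁? p v₁ S₁ ×-dec tree₂? S₂) ⊎-dec (tree₁? S₁ ×-dec forest₂? zero q S₂)
      separated : ∀ {S₁} → TwoForest H₁ p v₁ S₁ → ¬ SpanningTree H₁ S₁
      separated (_ , _ , p↛v₁ , _) (_ , _ , connected) = p↛v₁ (connected p v₁)

    f₁ : Fin a → ℕ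
    f₁ i = F₁ (i ↑ˡ 1) v₁

    F⁽¹⁾ : Fin a → Fin a → ℕ
    F⁽¹⁾ i j = F₁ (i ↑ˡ 1) (j ↑ˡ 1)

    f₂ : Fin b → ℕ
    f₂ k = F₂ (suc k) zero

    F⁽²⁾ : Fin b → Fin b → ℕ
    F⁽²⁾ k l = F₂ (suc k) (suc l)

    FG-left-left : ∀ i j → FG (i ↑ˡ suc b) (j ↑ˡ suc b) ≡ t₂ * F⁽¹⁾ i j
    FG-left-left i j = numTwoForests-within₁ (pre₁-left i) (pre₁-left j)

    FG-left-cut : ∀ i → FG (i ↑ˡ suc b) vG ≡ t₂ * f₁ i
    FG-left-cut i = numTwoForests-within₁ (pre₁-left i) pre₁-cut

    FG-cut-left : ∀ i → FG vG (i ↑ˡ suc b) ≡ t₂ * f₁ i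
    FG-cut-left i = trans (numTwoForests-within₁ pre₁-cut (pre₁-left i)) (cong (t₂ *_) (numTwoForests-sym H₁ TF₁ v₁ _))

    FG-cut-cut : FG vG vG ≡ 0
    FG-cut-cut = numTwoForests-diag G TFᴳ vG

    FG-cut-right : ∀ k → FG vG (a ↑ʳ suc k) ≡ t₁ * f₂ k
    FG-cut-right k = trans (numTwoForests-within₂ pre₂-cut (pre₂-right k)) (cong (t₁ *_) (numTwoForests-sym H₂ TF₂ zero _))

    FG-right-cut : ∀ k → FG (a ↑ʳ suc k) vG ≡ t₁ * f₂ k
    FG-right-cut k = numTwoForests-within₂ (pre₂-right k) pre₂-cut

    FG-right-right : ∀ k l → FG (a ↑ʳ suc k) (a ↑ʳ suc l) ≡ t₁ * F⁽²⁾ k l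
    FG-right-right k l = numTwoForests-within₂ (pre₂-right k) (pre₂-right l)

    FG-left-right : ∀ i k → FG (i ↑ˡ suc b) (a ↑ʳ suc k) ≡ t₂ * f₁ i + t₁ * f₂ k
    FG-left-right i k =
      trans (numTwoForests-across (pre₁-left i) (left≢cut i) (pre₂-right k) (right≢cut k))
            (cong (λ x → t₂ * f₁ i + t₁ * x) (numTwoForests-sym H₂ TF₂ zero (suc k)))

    FG-right-left : ∀ k i → FG (a ↑ʳ suc k) (i ↑ˡ suc b) ≡ t₁ * f₂ k + t₂ * f₁ i
    FG-right-left k i = trans (numTwoForests-sym G TFᴳ _ _) (trans (FG-left-right i k) (+-comm (t₂ * f₁ i) _))

    FG-block : ∀ u w → FG u w ≡ blockF t₁ t₂ F₁ F₂ u w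
    FG-block u w with view u | view w
    ... | is-left i  | is-left j  rewrite classify-left i  | classify-left j  = FG-left-left i j
    ... | is-left i  | is-cut     rewrite classify-left i  | classify-cut     = FG-left-cut i
    ... | is-left i  | is-right k rewrite classify-left i  | classify-right k = FG-left-right i k
    ... | is-cut     | is-left j  rewrite classify-cut     | classify-left j  = FG-cut-left j
    ... | is-cut     | is-cut     rewrite classify-cut                        = FG-cut-cut
    ... | is-cut     | is-right k rewrite classify-cut     | classify-right k = FG-cut-right k
    ... | is-right k | is-left i  rewrite classify-right k | classify-left i  = FG-right-left k i
    ... | is-right k | is-cut     rewrite classify-right k | classify-cut     = FG-right-cut k
    ... | is-right k | is-right l rewrite classify-right k | classify-right l = FG-right-right k l

    private
      move-middle : ∀ x t m y → x * (t * m) * y ≡ t * (x * m * y)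
      move-middle = solve-∀
      move-right : ∀ x t m s → x * (t * m) * s ≡ (t * s) * (x * m)
      move-right = solve-∀
      move-left : ∀ s t m x → s * (t * m) * x ≡ (t * s) * (x * m)
      move-left = solve-∀
      move-across : ∀ x t m t′ m′ y → x * (t * m + t′ * m′) * y ≡ (t * (x * m)) * y + (t′ * x) * (y * m′)
      move-across = solve-∀

    term : Fin (a + suc b) → Fin (a + suc b) → ℕ
    term u w = deg G u * FG u w * deg G w

    term-≡ : ∀ {u w x e y} → deg G u ≡ x → FG u w ≡ e → deg G w ≡ y → term u w ≡ x * e * y
    term-≡ du e dw = cong₂ _*_ (cong₂ _*_ du e) dw

    quad-glue-blocks : quad (deg G) FG
      ≡ t₂ * quad d₁ F⁽¹⁾ + t₁ * quad d₂ F⁽²⁾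
        + 2 * t₂ * (δ₁ + δ₂ + ∑ d₂) * dot d₁ f₁ + 2 * t₁ * (δ₁ + δ₂ + ∑ d₁) * dot d₂ f₂
    quad-glue-blocks =
      trans (∑∑-wedge term)
        (trans (cong₂ _+_ (cong₂ _+_ left-left (cong₂ _+_ left-cut left-right))
                          (cong₂ _+_ (cong₂ _+_ cut-left (cong₂ _+_ cut-cut cut-right))
                                     (cong₂ _+_ right-left (cong₂ _+_ right-cut right-right))))
               (collect t₁ t₂ (quad d₁ F⁽¹⁾) (quad d₂ F⁽²⁾) (δ₁ + δ₂) (dot d₁ f₁) (dot d₂ f₂) (∑ d₁) (∑ d₂)))
      where
      δ = δ₁ + δ₂
      left-left : ∑ (λ i → ∑ (λ j → term (i ↑ˡ suc b) (j ↑ˡ suc b))) ≡ t₂ * quad d₁ F⁽¹⁾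
      left-left = ∑∑-factorˡ t₂ (λ i j →
        trans (term-≡ (deg-left i) (FG-left-left i j) (deg-left j)) (move-middle (d₁ i) t₂ (F⁽¹⁾ i j) (d₁ j)))
      left-cut : ∑ (λ i → term (i ↑ˡ suc b) vG) ≡ (t₂ * δ) * dot d₁ f₁
      left-cut = ∑-factorˡ (t₂ * δ) (λ i →
        trans (term-≡ (deg-left i) (FG-left-cut i) deg-cut) (move-right (d₁ i) t₂ (f₁ i) δ))
      left-right : ∑ (λ i → ∑ (λ l → term (i ↑ˡ suc b) (a ↑ʳ suc l))) ≡ (t₂ * dot d₁ f₁) * ∑ d₂ + (t₁ * ∑ d₁) * dot d₂ f₂
      left-right =
        trans (∑∑-rank-two (λ i → t₂ * (d₁ i * f₁ i)) (λ i → t₁ * d₁ i) d₂ (λ l → d₂ l * f₂ l) (λ i l →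
                 trans (term-≡ (deg-left i) (FG-left-right i l) (deg-right l)) (move-across (d₁ i) t₂ (f₁ i) t₁ (f₂ l) (d₂ l))))
              (cong₂ _+_ (cong (_* ∑ d₂) (∑-*ˡ t₂ (λ i → d₁ i * f₁ i))) (cong (_* dot d₂ f₂) (∑-*ˡ t₁ d₁)))
      cut-left : ∑ (λ j → term vG (j ↑ˡ suc b)) ≡ (t₂ * δ) * dot d₁ f₁
      cut-left = ∑-factorˡ (t₂ * δ) (λ j →
        trans (term-≡ deg-cut (FG-cut-left j) (deg-left j)) (move-left δ t₂ (f₁ j) (d₁ j)))
      cut-cut : term vG vG ≡ 0
      cut-cut = trans (term-≡ deg-cut FG-cut-cut deg-cut) (cong (_* δ) (*-zeroʳ δ))
      cut-right : ∑ (λ l → term vG (a ↑ʳ suc l)) ≡ (t₁ * δ) * dot d₂ f₂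
      cut-right = ∑-factorˡ (t₁ * δ) (λ l →
        trans (term-≡ deg-cut (FG-cut-right l) (deg-right l)) (move-left δ t₁ (f₂ l) (d₂ l)))
      right-left : ∑ (λ k → ∑ (λ j → term (a ↑ʳ suc k) (j ↑ˡ suc b))) ≡ (t₁ * dot d₂ f₂) * ∑ d₁ + (t₂ * ∑ d₂) * dot d₁ f₁
      right-left =
        trans (∑∑-rank-two (λ k → t₁ * (d₂ k * f₂ k)) (λ k → t₂ * d₂ k) d₁ (λ j → d₁ j * f₁ j) (λ k j →
                 trans (term-≡ (deg-right k) (FG-right-left k j) (deg-left j)) (move-across (d₂ k) t₁ (f₂ k) t₂ (f₁ j) (d₁ j))))
              (cong₂ _+_ (cong (_* ∑ d₁) (∑-*ˡ t₁ (λ k → d₂ k * f₂ k))) (cong (_* dot d₁ f₁) (∑-*ˡ t₂ d₂)))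
      right-cut : ∑ (λ k → term (a ↑ʳ suc k) vG) ≡ (t₁ * δ) * dot d₂ f₂
      right-cut = ∑-factorˡ (t₁ * δ) (λ k →
        trans (term-≡ (deg-right k) (FG-right-cut k) deg-cut) (move-right (d₂ k) t₁ (f₂ k) δ))
      right-right : ∑ (λ k → ∑ (λ l → term (a ↑ʳ suc k) (a ↑ʳ suc l))) ≡ t₁ * quad d₂ F⁽²⁾
      right-right = ∑∑-factorˡ t₁ (λ k l →
        trans (term-≡ (deg-right k) (FG-right-right k l) (deg-right l)) (move-middle (d₂ k) t₁ (F⁽²⁾ k l) (d₂ l)))
      collect : ∀ t₁ t₂ q₁ q₂ δ x₁ x₂ Σ₁ Σ₂ →
          (t₂ * q₁ + ((t₂ * δ) * x₁ + ((t₂ * x₁) * Σ₂ + (t₁ * Σ₁) * x₂)))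
        + (((t₂ * δ) * x₁ + (0 + (t₁ * δ) * x₂)) + (((t₁ * x₂) * Σ₁ + (t₂ * Σ₂) * x₁) + ((t₁ * δ) * x₂ + t₁ * q₂)))
        ≡ t₂ * q₁ + t₁ * q₂ + 2 * t₂ * (δ + Σ₂) * x₁ + 2 * t₁ * (δ + Σ₁) * x₂
      collect = solve-∀

    quad₁-blocks : quad (deg H₁) F₁ ≡ quad d₁ F⁽¹⁾ + 2 * δ₁ * dot d₁ f₁
    quad₁-blocks =
      begin
        quad (deg H₁) F₁
      ≡⟨ trans (∑-cong (λ p → ∑-↑ a 1 (V p))) (∑-↑ a 1 (λ p → ∑ (λ j → V p (j ↑ˡ 1)) + (V p v₁ + 0))) ⟩
        ∑ (λ i → ∑ (λ j → V (i ↑ˡ 1) (j ↑ˡ 1)) + (V (i ↑ˡ 1) v₁ + 0)) + ((∑ (λ j → V v₁ (j ↑ˡ 1)) + (V v₁ v₁ + 0)) + 0)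
      ≡⟨ cong₂ _+_
           (trans (∑-+ (λ i → ∑ (λ j → V (i ↑ˡ 1) (j ↑ˡ 1))) (λ i → V (i ↑ˡ 1) v₁ + 0))
                  (cong (quad d₁ F⁽¹⁾ +_) (∑-factorˡ δ₁ (λ i → to-cut (d₁ i) (f₁ i) δ₁))))
           (cong (_+ 0) (cong₂ _+_
             (∑-factorˡ δ₁ (λ j → trans (cong (λ x → δ₁ * x * d₁ j) (numTwoForests-sym H₁ TF₁ v₁ (j ↑ˡ 1)))
                                         (from-cut δ₁ (f₁ j) (d₁ j))))
             (cong (λ x → δ₁ * x * δ₁ + 0) (numTwoForests-diag H₁ TF₁ v₁)))) ⟩
        (quad d₁ F⁽¹⁾ + δ₁ * dot d₁ f₁) + ((δ₁ * dot d₁ f₁ + (δ₁ * 0 * δ₁ + 0)) + 0)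
      ≡⟨ tidy (quad d₁ F⁽¹⁾) δ₁ (dot d₁ f₁) ⟩
        quad d₁ F⁽¹⁾ + 2 * δ₁ * dot d₁ f₁
      ∎
      where
      open ≡-Reasoning
      V : Fin (a + 1) → Fin (a + 1) → ℕ
      V p q = deg H₁ p * F₁ p q * deg H₁ q
      to-cut : ∀ x f δ → x * f * δ + 0 ≡ δ * (x * f)
      to-cut = solve-∀
      from-cut : ∀ δ f x → δ * f * x ≡ δ * (x * f)
      from-cut = solve-∀
      tidy : ∀ q δ x → (q + δ * x) + ((δ * x + (δ * 0 * δ + 0)) + 0) ≡ q + 2 * δ * x
      tidy = solve-∀

    quad₂-blocks : quad (deg H₂) F₂ ≡ 2 * δ₂ * dot d₂ f₂ + quad d₂ F⁽²⁾
    quad₂-blocks =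
      begin
        quad (deg H₂) F₂
      ≡⟨ cong₂ _+_
           (cong₂ _+_ (cong (λ x → δ₂ * x * δ₂) (numTwoForests-diag H₂ TF₂ zero))
                      (∑-factorˡ δ₂ (λ l → trans (cong (λ x → δ₂ * x * d₂ l) (numTwoForests-sym H₂ TF₂ zero (suc l)))
                                                 (from-cut δ₂ (f₂ l) (d₂ l)))))
           (trans (∑-+ (λ k → W (suc k) zero) (λ k → ∑ (λ l → W (suc k) (suc l))))
                  (cong (_+ quad d₂ F⁽²⁾) (∑-factorˡ δ₂ (λ k → to-cut (d₂ k) (f₂ k) δ₂)))) ⟩
        (δ₂ * 0 * δ₂ + δ₂ * dot d₂ f₂) + (δ₂ * dot d₂ f₂ + quad d₂ F⁽²⁾)
      ≡⟨ tidy (quad d₂ F⁽²⁾) δ₂ (dot d₂ f₂) ⟩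
        2 * δ₂ * dot d₂ f₂ + quad d₂ F⁽²⁾
      ∎
      where
      open ≡-Reasoning
      W : Fin (suc b) → Fin (suc b) → ℕ
      W p q = deg H₂ p * F₂ p q * deg H₂ q
      to-cut : ∀ x f δ → x * f * δ ≡ δ * (x * f)
      to-cut = solve-∀
      from-cut : ∀ δ f x → δ * f * x ≡ δ * (x * f)
      from-cut = solve-∀
      tidy : ∀ q δ x → (δ * 0 * δ + δ * x) + (δ * x + q) ≡ 2 * δ * x + q
      tidy = solve-∀

    dot₁-blocks : dot (deg H₁) (λ p → F₁ p v₁) ≡ dot d₁ f₁
    dot₁-blocks =
      trans (∑-↑ a 1 (λ p → deg H₁ p * F₁ p v₁))
        (trans (cong (λ x → dot d₁ f₁ + (δ₁ * x + 0)) (numTwoForests-diag H₁ TF₁ v₁))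
               (tidy (dot d₁ f₁) δ₁))
      where
      tidy : ∀ x δ → x + (δ * 0 + 0) ≡ x
      tidy = solve-∀

    dot₂-blocks : dot (deg H₂) (λ q → F₂ q zero) ≡ dot d₂ f₂
    dot₂-blocks = trans (cong (λ x → δ₂ * x + dot d₂ f₂) (numTwoForests-diag H₂ TF₂ zero))
                        (cong (_+ dot d₂ f₂) (*-zeroʳ δ₂))

    quad-glue : quad (deg G) FG
      ≡ t₂ * quad (deg H₁) F₁ + t₁ * quad (deg H₂) F₂
        + 4 * t₂ * numEdges H₂ * dot (deg H₁) (λ i → F₁ i v₁)
        + 4 * t₁ * numEdges H₁ * dot (deg H₂) (λ k → F₂ k zero)
    quad-glue =
      begin
        quad (deg G) FG
      ≡⟨ quad-glue-blocks ⟩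
        t₂ * quad d₁ F⁽¹⁾ + t₁ * quad d₂ F⁽²⁾
          + 2 * t₂ * (δ₁ + δ₂ + ∑ d₂) * dot d₁ f₁ + 2 * t₁ * (δ₁ + δ₂ + ∑ d₁) * dot d₂ f₂
      ≡⟨ regroup t₁ t₂ (quad d₁ F⁽¹⁾) (quad d₂ F⁽²⁾) δ₁ δ₂ (∑ d₁) (∑ d₂) (dot d₁ f₁) (dot d₂ f₂) ⟩
        t₂ * (quad d₁ F⁽¹⁾ + 2 * δ₁ * dot d₁ f₁) + t₁ * (2 * δ₂ * dot d₂ f₂ + quad d₂ F⁽²⁾)
          + 2 * t₂ * (δ₂ + ∑ d₂) * dot d₁ f₁ + 2 * t₁ * (∑ d₁ + δ₁) * dot d₂ f₂
      ≡⟨ cong₂ _+_ (cong₂ _+_ (cong₂ _+_ (cong (t₂ *_) quad₁-blocks) (cong (t₁ *_) quad₂-blocks))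
                              (cong₂ (λ m x → 2 * t₂ * m * x) edges₂ dot₁-blocks))
                   (cong₂ (λ m x → 2 * t₁ * m * x) edges₁ dot₂-blocks) ⟨
        t₂ * quad (deg H₁) F₁ + t₁ * quad (deg H₂) F₂
          + 2 * t₂ * (2 * numEdges H₂) * dot (deg H₁) (λ i → F₁ i v₁)
          + 2 * t₁ * (2 * numEdges H₁) * dot (deg H₂) (λ k → F₂ k zero)
      ≡⟨ double-twice t₁ t₂ (quad (deg H₁) F₁) (quad (deg H₂) F₂) (numEdges H₁) (numEdges H₂) _ _ ⟩
        t₂ * quad (deg H₁) F₁ + t₁ * quad (deg H₂) F₂
          + 4 * t₂ * numEdges H₂ * dot (deg H₁) (λ i → F₁ i v₁)
          + 4 * t₁ * numEdges H₁ * dot (deg H₂) (λ k → F₂ k zero)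
      ∎
      where
      open ≡-Reasoning
      regroup : ∀ t₁ t₂ q₁ q₂ δ₁ δ₂ Σ₁ Σ₂ x₁ x₂ →
          t₂ * q₁ + t₁ * q₂ + 2 * t₂ * (δ₁ + δ₂ + Σ₂) * x₁ + 2 * t₁ * (δ₁ + δ₂ + Σ₁) * x₂
        ≡ t₂ * (q₁ + 2 * δ₁ * x₁) + t₁ * (2 * δ₂ * x₂ + q₂) + 2 * t₂ * (δ₂ + Σ₂) * x₁ + 2 * t₁ * (Σ₁ + δ₁) * x₂
      regroup = solve-∀
      double-twice : ∀ t₁ t₂ q₁ q₂ m₁ m₂ x₁ x₂ →
          t₂ * q₁ + t₁ * q₂ + 2 * t₂ * (2 * m₂) * x₁ + 2 * t₁ * (2 * m₁) * x₂
        ≡ t₂ * q₁ + t₁ * q₂ + 4 * t₂ * m₂ * x₁ + 4 * t₁ * m₁ * x₂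
      double-twice = solve-∀

proposition3p1 : (a b : ℕ) (H₁ : Graph (a + 1)) (H₂ : Graph (suc b)) (G : Graph (a + suc b))
    → Connected H₁ → Connected H₂ → IsGlue H₁ H₂ G
    → (t₁ t₂ tG : ℕ)
    → (F₁ : Fin (a + 1) → Fin (a + 1) → ℕ) (F₂ : Fin (suc b) → Fin (suc b) → ℕ)
    → (FG : Fin (a + suc b) → Fin (a + suc b) → ℕ)
    → IsNumSpanningTrees H₁ t₁ → IsNumSpanningTrees H₂ t₂ → IsNumSpanningTrees G tG
    → (∀ i j → IsNumTwoForests H₁ i j (F₁ i j))
    → (∀ i j → IsNumTwoForests H₂ i j (F₂ i j))
    → (∀ u w → IsNumTwoForests G u w (FG u w))
    → (∀ u → deg G u ≡ padL H₁ u + padR {a = a} H₂ u)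
      × numEdges G ≡ numEdges H₁ + numEdges H₂
      × tG ≡ t₁ * t₂
      × (∀ u w → FG u w ≡ blockF t₁ t₂ F₁ F₂ u w)
      × quad (deg G) FG
          ≡ t₂ * quad (deg H₁) F₁ + t₁ * quad (deg H₂) F₂
            + 4 * t₂ * numEdges H₂ * dot (deg H₁) (λ i → F₁ i v₁)
            + 4 * t₁ * numEdges H₁ * dot (deg H₂) (λ k → F₂ k zero)
proposition3p1 a b H₁ H₂ G _ _ G-glue t₁ t₂ tG F₁ F₂ FG T₁ T₂ Tᴳ TF₁ TF₂ TFᴳ =
    deg-glue , numEdges-glue , numSpanningTrees-glue , FG-block , quad-glue
  where
  open Wedge-of-Fin.Glued-graphs a b H₁ H₂ G G-glue using (deg-glue; numEdges-glue)
  open Counting a b H₁ H₂ G G-glue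
  open Counting-with T₁ T₂ Tᴳ TF₁ TF₂ TFᴳ
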